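{- Let $n\ge 2$ and $m$ be positive integers, and let $R=\{x\in\mathbb{R}^n : x_1>x_2>\cdots>x_n>x_1-m\}$. Let $\eta,\lambda\in R\cap\mathbb{Z}^n$. For $k\ge0$ let $b_{\eta\lambda,k}$ be the number of walks of $k$ steps in $\mathbb{R}^n$ from $\eta$ to $\lambda$ with steps in $\{\pm e_1,\ldots,\pm e_n\}$ all of whose points lie in $R$, and let $g_{\eta\lambda}(x)=\sum_{k\ge0}b_{\eta\lambda,k}x^k/k!$. Then, as formal power series in $x$, $$g_{\eta\lambda}(x)=\sum_{\substack{(t_1,\ldots,t_n)\in\mathbb{Z}^n\\ t_1+\cdots+t_n=0}}\det_{1\le i,j\le n}\Big[I_{mt_i+\lambda_j-\eta_i}(2x)\Big],$$ where $I_\nu$ denotes the modified (hyperbolic) Bessel function, defined for integer $\nu$ by $\exp\!\big(x(z+z^{ -1})\big)=\sum_{\nu\in\mathbb{Z}}z^\nu I_\nu(2x)$, i.e. $I_\nu(2x)=\sum_{t\ge0,\,t+\nu\ge0}\frac{x^{2t+\nu}}{t!\,(t+\nu)!}$.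
   Context: $e_1,\ldots,e_n$ are the standard unit vectors of $\mathbb{R}^n$. A walk of $k$ steps from $\eta$ to $\lambda$ is a sequence of points $\eta=p_0,\ldots,p_k=\lambda$ with each $p_\ell-p_{\ell-1}$ an allowed step. The region $R$ is the alcove of the affine Weyl group $\tilde A_{n-1}$ rescaled by $m$, considered in all of $\mathbb{R}^n$. -}

module Defs where

open import Data.Nat as ℕ using (ℕ; zero; suc; _∸_; _!)
open import Data.Nat.Properties using (_!*_!≢0; _!≢0)
open import Data.Integer as ℤ using (ℤ; +_; -[1+_]; ∣_∣)
open import Data.Integer.Properties as ℤP using ()
open import Data.Rational as ℚ using (ℚ; 0ℚ; 1ℚ)
open import Data.Bool using (Bool; true; false; if_then_else_)
open import Data.Fin using (Fin; zero; suc; punchIn)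
open import Data.Product using (_×_; _,_)
open import Data.Unit using (⊤)
open import Data.List as L using (List; []; _∷_; upTo; concatMap; filter; length; allFin)
open import Data.List.Relation.Unary.All as All using (All)
open import Data.List.Relation.Unary.Linked using (Linked; linked?)
open import Data.Vec as V using (Vec; toList; updateAt)
open import Relation.Nullary using (Dec; yes; no; _×-dec_)
open import Relation.Binary.PropositionalEquality using (_≡_)
import Data.Vec.Properties as VP

-- Formal power series in x with rational coefficients: k ↦ [x^k]

FPS : Set
FPS = ℕ → ℚ

sumℚ : List ℚ → ℚ
sumℚ = L.foldr ℚ._+_ 0ℚ

_⊕_ : FPS → FPS → FPS
(f ⊕ g) k = f k ℚ.+ g k

⊖_ : FPS → FPS
(⊖ f) k = ℚ.- (f k)

zeroS : FPS
zeroS _ = 0ℚ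

oneS : FPS
oneS zero    = 1ℚ
oneS (suc _) = 0ℚ

_⊗_ : FPS → FPS → FPS
(f ⊗ g) k = sumℚ (L.map (λ i → f i ℚ.* g (k ∸ i)) (upTo (suc k)))

sumS : List FPS → FPS
sumS = L.foldr _⊕_ zeroS

sgnS : ℕ → FPS → FPS
sgnS zero    f = f
sgnS (suc j) f = ⊖ (sgnS j f)

det : (n : ℕ) → (Fin n → Fin n → FPS) → FPS
det zero    M = oneS
det (suc n) M =
  sumS (L.map (λ j → sgnS (Data.Fin.toℕ j)
                 (M zero j ⊗ det n (λ r c → M (suc r) (punchIn j c))))
              (allFin (suc n)))

besselTerm : ℤ → ℕ → ℕ → ℚ
besselTerm ν k t with (+ (2 ℕ.* t)) ℤ.+ ν ℤ.≟ + k | + 0 ℤ.≤? + t ℤ.+ ν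
... | yes _ | yes _ = ℚ._/_ (+ 1) (t ! ℕ.* ∣ + t ℤ.+ ν ∣ !) {{t !* ∣ + t ℤ.+ ν ∣ !≢0}}
... | _     | _     = 0ℚ

-- coefficient of x^k in I_ν(2x); only t ≤ k can contribute
besselI2x : ℤ → FPS
besselI2x ν k = sumℚ (L.map (besselTerm ν k) (upTo (suc k)))

lastOr : ℤ → List ℤ → ℤ
lastOr d []       = d
lastOr d (y ∷ ys) = lastOr y ys

WrapCond : ℕ → List ℤ → Set
WrapCond m []       = ⊤
WrapCond m (x ∷ xs) = x ℤ.- + m ℤ.< lastOr x xs

wrap? : ∀ m xs → Dec (WrapCond m xs)
wrap? m []       = yes _
wrap? m (x ∷ xs) = x ℤ.- + m ℤP.<? lastOr x xs

InR : ∀ {n} → ℕ → Vec ℤ n → Set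
InR m x = Linked ℤ._>_ (toList x) × WrapCond m (toList x)

inR? : ∀ {n} m (x : Vec ℤ n) → Dec (InR m x)
inR? m x = linked? (λ a b → b ℤP.<? a) (toList x) ×-dec wrap? m (toList x)

Step : ℕ → Set
Step n = Fin n × Bool

allSteps : (n : ℕ) → List (Step n)
allSteps n = concatMap (λ i → (i , true) ∷ (i , false) ∷ []) (allFin n)

move : ∀ {n} → Vec ℤ n → Step n → Vec ℤ n
move p (i , true)  = updateAt p i (ℤ._+ + 1)
move p (i , false) = updateAt p i (ℤ._- + 1)

stepSeqs : (n k : ℕ) → List (List (Step n))
stepSeqs n zero    = [] ∷ []
stepSeqs n (suc k) = concatMap (λ s → L.map (s ∷_) (stepSeqs n k)) (allSteps n)

points : ∀ {n} → Vec ℤ n → List (Step n) → List (Vec ℤ n)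
points p []       = p ∷ []
points p (s ∷ ss) = p ∷ points (move p s) ss

endpoint : ∀ {n} → Vec ℤ n → List (Step n) → Vec ℤ n
endpoint p []       = p
endpoint p (s ∷ ss) = endpoint (move p s) ss

ValidWalk : ∀ {n} → ℕ → Vec ℤ n → Vec ℤ n → List (Step n) → Set
ValidWalk m η λ' w = All (InR m) (points η w) × endpoint η w ≡ λ'

validWalk? : ∀ {n} m (η λ' : Vec ℤ n) w → Dec (ValidWalk m η λ' w)
validWalk? m η λ' w = All.all? (inR? m) (points η w) ×-dec VP.≡-dec ℤ._≟_ (endpoint η w) λ'

numWalks : (n m : ℕ) → Vec ℤ n → Vec ℤ n → ℕ → ℕ
numWalks n m η λ' k = length (filter (validWalk? m η λ') (stepSeqs n k))

gSeries : (n m : ℕ) → Vec ℤ n → Vec ℤ n → FPS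
gSeries n m η λ' k = ℚ._/_ (+ numWalks n m η λ' k) (k !) {{k !≢0}}

-- Summation over t ∈ ℤⁿ with t₁ + ⋯ + tₙ = 0, via boxes [-B,B]ⁿ

rangeℤ : ℕ → List ℤ
rangeℤ B = L.map (λ i → + i ℤ.- + B) (upTo (suc (2 ℕ.* B)))

vecsOver : (n : ℕ) → List ℤ → List (Vec ℤ n)
vecsOver zero    xs = V.[] ∷ []
vecsOver (suc n) xs = concatMap (λ x → L.map (x V.∷_) (vecsOver n xs)) xs

sumℤ : ∀ {n} → Vec ℤ n → ℤ
sumℤ = V.foldr _ ℤ._+_ (+ 0)

boxZeroSum : (n B : ℕ) → List (Vec ℤ n)
boxZeroSum n B = filter (λ t → sumℤ t ℤ.≟ + 0) (vecsOver n (rangeℤ B))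

detTerm : (n m : ℕ) → Vec ℤ n → Vec ℤ n → Vec ℤ n → FPS
detTerm n m η λ' t =
  det n (λ i j → besselI2x (+ m ℤ.* V.lookup t i ℤ.+ V.lookup λ' j ℤ.- V.lookup η i))

rhsBox : (n m : ℕ) → Vec ℤ n → Vec ℤ n → ℕ → FPS
rhsBox n m η λ' B = sumS (L.map (detTerm n m η λ') (boxZeroSum n B))

module Submission where

-- Both sides satisfy the same recurrence with the same initial values. For η ∈ R a walk is a
-- first step s followed by a walk from η + s, so b_{k+1}(η) = Σ_s b_k(η + s), where b vanishes
-- off R and b_0(η) = [η = λ]. Write S_k(η) for the coefficient of x^k in the determinant sum.
-- Row i of the matrix depends on η only through η_i, so differentiating the determinant row by
-- row and using I_ν′ = I_{ν-1} + I_{ν+1} gives (k + 1) S_{k+1}(η) = Σ_s S_k(η + s) for every η.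
-- The reflections of the affine Weyl group in the walls x_a = x_b and x_z = x_l + m permute the
-- lattice {t : Σ t = 0} and exchange two rows of the matrix, so S vanishes on the walls; these
-- walls are exactly the points one step outside R. At k = 0 only t = 0 contributes, with
-- S_0(η) = det[λ_j = η_i] = [η = λ]. Hence k! S_k = b_k. For each k only finitely many t
-- contribute to the coefficient of x^k, so the sum over a large enough box is exact.

open import Level using (0ℓ)
open import Function using (_∘_)
open import Data.Empty using (⊥; ⊥-elim)
open import Data.Maybe using (nothing)
open import Data.Bool using (true; false)
open import Data.Product using (Σ; ∃; _×_; _,_; proj₁; proj₂)
open import Data.Sum using (_⊎_; inj₁; inj₂)
open import Data.Nat as ℕ using (ℕ; zero; suc; _∸_; z≤n; s≤s; _!; _≤_; NonZero)
open import Data.Nat.Properties as ℕP using (_!≢0; _!*_!≢0)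
open import Data.Integer as ℤ using (ℤ; +_; -[1+_])
import Data.Integer.Properties as ℤP
import Data.Integer.Tactic.RingSolver as ℤ-Solver
open import Data.Rational as ℚ using (ℚ; 0ℚ; 1ℚ)
import Data.Rational.Properties as ℚP
open import Data.Rational.Unnormalised as ℚᵘ using (mkℚᵘ; *≡*)
import Data.Rational.Unnormalised.Properties as ℚᵘP
open import Data.Fin as F using (Fin; zero; suc; punchIn; punchOut; toℕ)
import Data.Fin.Properties as FP
open import Data.List as L using (List; []; _∷_; upTo; applyUpTo; allFin; concatMap; filter; length; _++_)
import Data.List.Properties as LP
open import Data.List.Relation.Unary.All as All using (_∷_)
open import Data.List.Relation.Unary.Linked as Linked using (Linked; []; [-]; _∷_)
open import Data.Vec as V using (Vec; lookup; updateAt; toList)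
import Data.Vec.Properties as VP
open import Relation.Binary.PropositionalEquality
open import Relation.Binary.Definitions using (tri<; tri≈; tri>)
open import Relation.Nullary using (Dec; yes; no; ¬_)
open import Relation.Unary using (Pred; Decidable)
open import Algebra.Bundles using (CommutativeRing)
open import Algebra.Structures using (IsCommutativeRing)
open import Tactic.RingSolver using (solve-∀)
open import Tactic.RingSolver.Core.AlmostCommutativeRing using (AlmostCommutativeRing; fromCommutativeRing)
open import Defs
open import Algebra.Properties.Semiring.Mult (CommutativeRing.semiring ℚP.+-*-commutativeRing)
  using (×-homo-+; ×1-homo-*) renaming (_×_ to _×ℚ_)

ℚ-ring : AlmostCommutativeRing 0ℓ 0ℓ
ℚ-ring = fromCommutativeRing ℚP.+-*-commutativeRing (λ _ → nothing)

Σ< : ℕ → (ℕ → ℚ) → ℚ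
Σ< zero    h = 0ℚ
Σ< (suc n) h = h 0 ℚ.+ Σ< n (h ∘ suc)

sumℚ-map-applyUpTo : ∀ n (h : ℕ → ℚ) (f : ℕ → ℕ) → sumℚ (L.map h (applyUpTo f n)) ≡ Σ< n (h ∘ f)
sumℚ-map-applyUpTo zero    h f = refl
sumℚ-map-applyUpTo (suc n) h f = cong (h (f 0) ℚ.+_) (sumℚ-map-applyUpTo n h (f ∘ suc))

sumℚ-map-upTo : ∀ n (h : ℕ → ℚ) → sumℚ (L.map h (upTo n)) ≡ Σ< n h
sumℚ-map-upTo n h = sumℚ-map-applyUpTo n h (λ i → i)

Σ<-cong : ∀ n {h g : ℕ → ℚ} → (∀ i → i ℕ.< n → h i ≡ g i) → Σ< n h ≡ Σ< n g
Σ<-cong zero    eq = refl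
Σ<-cong (suc n) eq = cong₂ ℚ._+_ (eq 0 (s≤s z≤n)) (Σ<-cong n (λ i i<n → eq (suc i) (s≤s i<n)))

Σ<-snoc : ∀ n (h : ℕ → ℚ) → Σ< (suc n) h ≡ Σ< n h ℚ.+ h n
Σ<-snoc zero    h = trans (ℚP.+-identityʳ (h 0)) (sym (ℚP.+-identityˡ (h 0)))
Σ<-snoc (suc n) h = trans (cong (h 0 ℚ.+_) (Σ<-snoc n (h ∘ suc))) (sym (ℚP.+-assoc (h 0) _ _))

Σ<-distrib-+ : ∀ n (h g : ℕ → ℚ) → Σ< n (λ i → h i ℚ.+ g i) ≡ Σ< n h ℚ.+ Σ< n g
Σ<-distrib-+ zero    h g = refl
Σ<-distrib-+ (suc n) h g =
  trans (cong (h 0 ℚ.+ g 0 ℚ.+_) (Σ<-distrib-+ n (h ∘ suc) (g ∘ suc)))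
        (interchange (h 0) (g 0) (Σ< n (h ∘ suc)) (Σ< n (g ∘ suc)))
  where
  interchange : ∀ a b c d → a ℚ.+ b ℚ.+ (c ℚ.+ d) ≡ a ℚ.+ c ℚ.+ (b ℚ.+ d)
  interchange = solve-∀ ℚ-ring

*-distribˡ-Σ< : ∀ n (c : ℚ) (h : ℕ → ℚ) → Σ< n (λ i → c ℚ.* h i) ≡ c ℚ.* Σ< n h
*-distribˡ-Σ< zero    c h = sym (ℚP.*-zeroʳ c)
*-distribˡ-Σ< (suc n) c h =
  trans (cong (c ℚ.* h 0 ℚ.+_) (*-distribˡ-Σ< n c (h ∘ suc))) (sym (ℚP.*-distribˡ-+ c (h 0) _))

Σ<-zero : ∀ n (h : ℕ → ℚ) → (∀ i → i ℕ.< n → h i ≡ 0ℚ) → Σ< n h ≡ 0ℚ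
Σ<-zero zero    h eq = refl
Σ<-zero (suc n) h eq =
  cong₂ ℚ._+_ (eq 0 (s≤s z≤n)) (Σ<-zero n (h ∘ suc) (λ i i<n → eq (suc i) (s≤s i<n)))

Σ<-select : ∀ n (h : ℕ → ℚ) a → a ℕ.< n → (∀ i → i ≢ a → h i ≡ 0ℚ) → Σ< n h ≡ h a
Σ<-select (suc n) h zero a<n eq =
  trans (cong (h 0 ℚ.+_) (Σ<-zero n (h ∘ suc) (λ i _ → eq (suc i) (λ ())))) (ℚP.+-identityʳ _)
Σ<-select (suc n) h (suc a) (s≤s a<n) eq =
  trans (cong₂ ℚ._+_ (eq 0 (λ ())) (Σ<-select n (h ∘ suc) a a<n (λ i i≢a → eq (suc i) (i≢a ∘ ℕP.suc-injective))))
        (ℚP.+-identityˡ _)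

Σ<-reverse : ∀ n (h : ℕ → ℚ) → Σ< n h ≡ Σ< n (λ i → h (n ∸ suc i))
Σ<-reverse zero    h = refl
Σ<-reverse (suc n) h = begin
  h 0 ℚ.+ Σ< n (h ∘ suc)                              ≡⟨ cong (h 0 ℚ.+_) (Σ<-reverse n (h ∘ suc)) ⟩
  h 0 ℚ.+ Σ< n (λ i → h (suc (n ∸ suc i)))            ≡⟨ ℚP.+-comm (h 0) _ ⟩
  Σ< n (λ i → h (suc (n ∸ suc i))) ℚ.+ h 0            ≡⟨ cong₂ ℚ._+_ (Σ<-cong n (λ i i<n → cong h (sym (ℕP.+-∸-assoc 1 i<n))))
                                                                     (cong h (sym (ℕP.n∸n≡0 n))) ⟩
  Σ< n (λ i → h (suc n ∸ suc i)) ℚ.+ h (suc n ∸ suc n) ≡⟨ Σ<-snoc n (λ i → h (suc n ∸ suc i)) ⟨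
  Σ< (suc n) (λ i → h (suc n ∸ suc i))                ∎
  where open ≡-Reasoning

Σ<-triangle : ∀ k (F : ℕ → ℕ → ℚ) →
  Σ< (suc k) (λ i → Σ< (suc i) (λ a → F a i)) ≡ Σ< (suc k) (λ a → Σ< (suc (k ∸ a)) (λ b → F a (a ℕ.+ b)))
Σ<-triangle zero    F = refl
Σ<-triangle (suc k) F = begin
  Σ< (suc (suc k)) (λ i → Σ< (suc i) (λ a → F a i))
    ≡⟨ Σ<-snoc (suc k) (λ i → Σ< (suc i) (λ a → F a i)) ⟩
  Σ< (suc k) (λ i → Σ< (suc i) (λ a → F a i)) ℚ.+ Σ< (suc (suc k)) (λ a → F a (suc k))
    ≡⟨ cong₂ ℚ._+_ (Σ<-triangle k F) (Σ<-snoc (suc k) (λ a → F a (suc k))) ⟩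
  ΣRow ℚ.+ (Σ< (suc k) (λ a → F a (suc k)) ℚ.+ F (suc k) (suc k))
    ≡⟨ ℚP.+-assoc ΣRow _ _ ⟨
  ΣRow ℚ.+ Σ< (suc k) (λ a → F a (suc k)) ℚ.+ F (suc k) (suc k)
    ≡⟨ cong (ℚ._+ F (suc k) (suc k)) (Σ<-distrib-+ (suc k) Row (λ a → F a (suc k))) ⟨
  Σ< (suc k) (λ a → Row a ℚ.+ F a (suc k)) ℚ.+ F (suc k) (suc k)
    ≡⟨ cong₂ ℚ._+_ (Σ<-cong (suc k) extendRow) lastRow ⟩
  Σ< (suc k) Row′ ℚ.+ Row′ (suc k)
    ≡⟨ Σ<-snoc (suc k) Row′ ⟨
  Σ< (suc (suc k)) Row′ ∎
  where
  open ≡-Reasoning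
  Row Row′ : ℕ → ℚ
  Row  a = Σ< (suc (k ∸ a)) (λ b → F a (a ℕ.+ b))
  Row′ a = Σ< (suc (suc k ∸ a)) (λ b → F a (a ℕ.+ b))
  ΣRow = Σ< (suc k) Row
  lastRow : F (suc k) (suc k) ≡ Row′ (suc k)
  lastRow = trans (sym (ℚP.+-identityʳ _))
                  (cong₂ (λ x y → F (suc k) x ℚ.+ Σ< y (λ b → F (suc k) (suc k ℕ.+ suc b)))
                         (sym (ℕP.+-identityʳ (suc k))) (sym (ℕP.n∸n≡0 (suc k))))
  extendRow : ∀ a → a ℕ.< suc k → Row a ℚ.+ F a (suc k) ≡ Row′ a
  extendRow a (s≤s a≤k) = begin
    Row a ℚ.+ F a (suc k)                                ≡⟨ cong (λ z → Row a ℚ.+ F a z) k+1≡a+[k-a+1] ⟩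
    Row a ℚ.+ F a (a ℕ.+ suc (k ∸ a))                    ≡⟨ Σ<-snoc (suc (k ∸ a)) (λ b → F a (a ℕ.+ b)) ⟨
    Σ< (suc (suc (k ∸ a))) (λ b → F a (a ℕ.+ b))         ≡⟨ cong (λ z → Σ< (suc z) (λ b → F a (a ℕ.+ b))) (ℕP.+-∸-assoc 1 a≤k) ⟨
    Row′ a                                               ∎
    where
    k+1≡a+[k-a+1] : suc k ≡ a ℕ.+ suc (k ∸ a)
    k+1≡a+[k-a+1] = trans (cong suc (sym (ℕP.m+[n∸m]≡n a≤k))) (sym (ℕP.+-suc a (k ∸ a)))

-- The ring of formal power series

infix 4 _≈_
record _≈_ (f g : FPS) : Set where
  constructor mk≈
  field coeff : ∀ k → f k ≡ g k
open _≈_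

≈-refl : ∀ {f} → f ≈ f
≈-refl = mk≈ λ k → refl

≈-sym : ∀ {f g} → f ≈ g → g ≈ f
≈-sym p = mk≈ λ k → sym (coeff p k)

≈-trans : ∀ {f g h} → f ≈ g → g ≈ h → f ≈ h
≈-trans p q = mk≈ λ k → trans (coeff p k) (coeff q k)

≈-reflexive : ∀ {f g} → f ≡ g → f ≈ g
≈-reflexive refl = ≈-refl

⊕-cong : ∀ {f f′ g g′} → f ≈ f′ → g ≈ g′ → f ⊕ g ≈ f′ ⊕ g′
⊕-cong p q = mk≈ λ k → cong₂ ℚ._+_ (coeff p k) (coeff q k)

⊖-cong : ∀ {f g} → f ≈ g → ⊖ f ≈ ⊖ g
⊖-cong p = mk≈ λ k → cong ℚ.-_ (coeff p k)

⊗-coeff : ∀ f g k → (f ⊗ g) k ≡ Σ< (suc k) (λ i → f i ℚ.* g (k ∸ i))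
⊗-coeff f g k = sumℚ-map-upTo (suc k) (λ i → f i ℚ.* g (k ∸ i))

⊗-cong : ∀ {f f′ g g′} → f ≈ f′ → g ≈ g′ → f ⊗ g ≈ f′ ⊗ g′
⊗-cong {f} {f′} {g} {g′} p q = mk≈ λ k → begin
  (f ⊗ g) k                             ≡⟨ ⊗-coeff f g k ⟩
  Σ< (suc k) (λ i → f i ℚ.* g (k ∸ i))   ≡⟨ Σ<-cong (suc k) (λ i _ → cong₂ ℚ._*_ (coeff p i) (coeff q (k ∸ i))) ⟩
  Σ< (suc k) (λ i → f′ i ℚ.* g′ (k ∸ i)) ≡⟨ ⊗-coeff f′ g′ k ⟨
  (f′ ⊗ g′) k                           ∎
  where open ≡-Reasoning

⊗-congˡ : ∀ f {g g′} → g ≈ g′ → f ⊗ g ≈ f ⊗ g′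
⊗-congˡ f = ⊗-cong (≈-refl {f})

⊗-congʳ : ∀ g {f f′} → f ≈ f′ → f ⊗ g ≈ f′ ⊗ g
⊗-congʳ g p = ⊗-cong p (≈-refl {g})

⊗-comm : ∀ f g → f ⊗ g ≈ g ⊗ f
⊗-comm f g = mk≈ λ k → begin
  (f ⊗ g) k                                            ≡⟨ ⊗-coeff f g k ⟩
  Σ< (suc k) (λ i → f i ℚ.* g (k ∸ i))                  ≡⟨ Σ<-reverse (suc k) (λ i → f i ℚ.* g (k ∸ i)) ⟩
  Σ< (suc k) (λ i → f (k ∸ i) ℚ.* g (k ∸ (k ∸ i)))      ≡⟨ Σ<-cong (suc k) (λ i i≤k → flip (k ∸ i) (ℕP.m∸[m∸n]≡n (ℕP.≤-pred i≤k))) ⟩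
  Σ< (suc k) (λ i → g i ℚ.* f (k ∸ i))                  ≡⟨ ⊗-coeff g f k ⟨
  (g ⊗ f) k                                            ∎
  where
  open ≡-Reasoning
  flip : ∀ a {i j} → j ≡ i → f a ℚ.* g j ≡ g i ℚ.* f a
  flip a {i} refl = ℚP.*-comm (f a) (g i)

⊗-assoc : ∀ f g h → (f ⊗ g) ⊗ h ≈ f ⊗ (g ⊗ h)
⊗-assoc f g h = mk≈ coeffwise
  where
  open ≡-Reasoning
  rotate : ∀ x y z → x ℚ.* (y ℚ.* z) ≡ y ℚ.* (z ℚ.* x)
  rotate = solve-∀ ℚ-ring
  coeffwise : ∀ k → ((f ⊗ g) ⊗ h) k ≡ (f ⊗ (g ⊗ h)) k
  coeffwise k = begin
    ((f ⊗ g) ⊗ h) k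
      ≡⟨ ⊗-coeff (f ⊗ g) h k ⟩
    Σ< (suc k) (λ i → (f ⊗ g) i ℚ.* h (k ∸ i))
      ≡⟨ Σ<-cong (suc k) (λ i _ → expandLeft i) ⟩
    Σ< (suc k) (λ i → Σ< (suc i) (λ a → h (k ∸ i) ℚ.* (f a ℚ.* g (i ∸ a))))
      ≡⟨ Σ<-triangle k (λ a i → h (k ∸ i) ℚ.* (f a ℚ.* g (i ∸ a))) ⟩
    Σ< (suc k) (λ a → Σ< (suc (k ∸ a)) (λ b → h (k ∸ (a ℕ.+ b)) ℚ.* (f a ℚ.* g ((a ℕ.+ b) ∸ a))))
      ≡⟨ Σ<-cong (suc k) (λ a _ → trans (Σ<-cong (suc (k ∸ a)) (λ b _ → regroup a b))
                                        (*-distribˡ-Σ< (suc (k ∸ a)) (f a) (λ b → g b ℚ.* h (k ∸ a ∸ b)))) ⟩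
    Σ< (suc k) (λ a → f a ℚ.* Σ< (suc (k ∸ a)) (λ b → g b ℚ.* h (k ∸ a ∸ b)))
      ≡⟨ Σ<-cong (suc k) (λ a _ → cong (f a ℚ.*_) (sym (⊗-coeff g h (k ∸ a)))) ⟩
    Σ< (suc k) (λ a → f a ℚ.* (g ⊗ h) (k ∸ a))
      ≡⟨ ⊗-coeff f (g ⊗ h) k ⟨
    (f ⊗ (g ⊗ h)) k ∎
    where
    expandLeft : ∀ i → (f ⊗ g) i ℚ.* h (k ∸ i) ≡ Σ< (suc i) (λ a → h (k ∸ i) ℚ.* (f a ℚ.* g (i ∸ a)))
    expandLeft i = begin
      (f ⊗ g) i ℚ.* h (k ∸ i)                              ≡⟨ cong (ℚ._* h (k ∸ i)) (⊗-coeff f g i) ⟩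
      Σ< (suc i) (λ a → f a ℚ.* g (i ∸ a)) ℚ.* h (k ∸ i)    ≡⟨ ℚP.*-comm _ (h (k ∸ i)) ⟩
      h (k ∸ i) ℚ.* Σ< (suc i) (λ a → f a ℚ.* g (i ∸ a))    ≡⟨ *-distribˡ-Σ< (suc i) (h (k ∸ i)) (λ a → f a ℚ.* g (i ∸ a)) ⟨
      Σ< (suc i) (λ a → h (k ∸ i) ℚ.* (f a ℚ.* g (i ∸ a)))  ∎
    regroup : ∀ a b → h (k ∸ (a ℕ.+ b)) ℚ.* (f a ℚ.* g ((a ℕ.+ b) ∸ a)) ≡ f a ℚ.* (g b ℚ.* h (k ∸ a ∸ b))
    regroup a b rewrite ℕP.m+n∸m≡n a b | sym (ℕP.∸-+-assoc k a b) = rotate (h (k ∸ a ∸ b)) (f a) (g b)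

⊗-identityˡ : ∀ f → oneS ⊗ f ≈ f
⊗-identityˡ f = mk≈ λ k →
  trans (⊗-coeff oneS f k)
        (trans (Σ<-select (suc k) (λ i → oneS i ℚ.* f (k ∸ i)) 0 (s≤s z≤n) offDiagonal) (ℚP.*-identityˡ (f k)))
  where
  offDiagonal : ∀ {k} i → i ≢ 0 → oneS i ℚ.* f (k ∸ i) ≡ 0ℚ
  offDiagonal zero      i≢0 = ⊥-elim (i≢0 refl)
  offDiagonal {k} (suc i) _ = ℚP.*-zeroˡ (f (k ∸ suc i))

⊗-distribˡ-⊕ : ∀ f g h → f ⊗ (g ⊕ h) ≈ (f ⊗ g) ⊕ (f ⊗ h)
⊗-distribˡ-⊕ f g h = mk≈ λ k → begin
  (f ⊗ (g ⊕ h)) k                                              ≡⟨ ⊗-coeff f (g ⊕ h) k ⟩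
  Σ< (suc k) (λ i → f i ℚ.* (g (k ∸ i) ℚ.+ h (k ∸ i)))           ≡⟨ Σ<-cong (suc k) (λ i _ → ℚP.*-distribˡ-+ (f i) (g (k ∸ i)) (h (k ∸ i))) ⟩
  Σ< (suc k) (λ i → f i ℚ.* g (k ∸ i) ℚ.+ f i ℚ.* h (k ∸ i))     ≡⟨ Σ<-distrib-+ (suc k) (λ i → f i ℚ.* g (k ∸ i)) (λ i → f i ℚ.* h (k ∸ i)) ⟩
  Σ< (suc k) (λ i → f i ℚ.* g (k ∸ i)) ℚ.+ Σ< (suc k) (λ i → f i ℚ.* h (k ∸ i))
                                                               ≡⟨ cong₂ ℚ._+_ (⊗-coeff f g k) (⊗-coeff f h k) ⟨
  ((f ⊗ g) ⊕ (f ⊗ h)) k                                        ∎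
  where open ≡-Reasoning

FPS-isCommutativeRing : IsCommutativeRing _≈_ _⊕_ _⊗_ ⊖_ zeroS oneS
FPS-isCommutativeRing = record
  { isRing = record
    { +-isAbelianGroup = record
      { isGroup = record
        { isMonoid = record
          { isSemigroup = record
            { isMagma = record
              { isEquivalence = record { refl = ≈-refl ; sym = ≈-sym ; trans = ≈-trans }
              ; ∙-cong = ⊕-cong }
            ; assoc = λ f g h → mk≈ λ k → ℚP.+-assoc (f k) (g k) (h k) }
          ; identity = (λ f → mk≈ λ k → ℚP.+-identityˡ (f k)) , (λ f → mk≈ λ k → ℚP.+-identityʳ (f k)) }
        ; inverse = (λ f → mk≈ λ k → ℚP.+-inverseˡ (f k)) , (λ f → mk≈ λ k → ℚP.+-inverseʳ (f k))
        ; ⁻¹-cong = ⊖-cong }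
      ; comm = λ f g → mk≈ λ k → ℚP.+-comm (f k) (g k) }
    ; *-cong = ⊗-cong
    ; *-assoc = ⊗-assoc
    ; *-identity = ⊗-identityˡ , (λ f → ≈-trans (⊗-comm f oneS) (⊗-identityˡ f))
    ; distrib = ⊗-distribˡ-⊕ , ⊗-distribʳ-⊕
    }
  ; *-comm = ⊗-comm
  }
  where
  ⊗-distribʳ-⊕ : ∀ f g h → (g ⊕ h) ⊗ f ≈ (g ⊗ f) ⊕ (h ⊗ f)
  ⊗-distribʳ-⊕ f g h =
    ≈-trans (⊗-comm (g ⊕ h) f) (≈-trans (⊗-distribˡ-⊕ f g h) (⊕-cong (⊗-comm f g) (⊗-comm f h)))

FPS-commutativeRing : CommutativeRing 0ℓ 0ℓ
FPS-commutativeRing = record { isCommutativeRing = FPS-isCommutativeRing }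

FPS-ring : AlmostCommutativeRing 0ℓ 0ℓ
FPS-ring = fromCommutativeRing FPS-commutativeRing (λ _ → nothing)

module FPS = CommutativeRing FPS-commutativeRing

open import Algebra.Properties.Semiring.Sum FPS.semiring
  using (sum; ∑-comm; sum-remove; sum-cong-≋; *-distribˡ-sum; ∑-distrib-+)
import Algebra.Properties.Ring FPS.ring as FPSₚ

-- Determinants

Mat : ℕ → Set
Mat n = Fin n → Fin n → FPS

minor : ∀ {n} → Mat (suc n) → Fin (suc n) → Mat n
minor M j r c = M (suc r) (punchIn j c)

laplaceTerm : ∀ {n} → Mat (suc n) → Fin (suc n) → FPS
laplaceTerm {n} M j = sgnS (toℕ j) (M zero j ⊗ det n (minor M j))

sumS-map-allFin : ∀ n (h : Fin n → FPS) → sumS (L.map h (allFin n)) ≡ sum h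
sumS-map-allFin n h = trans (cong sumS (LP.map-tabulate (λ i → i) h)) (sumS-tabulate n h)
  where
  sumS-tabulate : ∀ n (h : Fin n → FPS) → sumS (L.tabulate h) ≡ sum h
  sumS-tabulate zero    h = refl
  sumS-tabulate (suc n) h = cong (h zero ⊕_) (sumS-tabulate n (h ∘ suc))

det-laplace : ∀ n (M : Mat (suc n)) → det (suc n) M ≈ sum (laplaceTerm M)
det-laplace n M = ≈-reflexive (sumS-map-allFin (suc n) (laplaceTerm M))

sgnS-cong : ∀ j {f g} → f ≈ g → sgnS j f ≈ sgnS j g
sgnS-cong zero    p = p
sgnS-cong (suc j) p = ⊖-cong (sgnS-cong j p)

sgnS-⊕ : ∀ j f g → sgnS j (f ⊕ g) ≈ sgnS j f ⊕ sgnS j g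
sgnS-⊕ zero    f g = ≈-refl
sgnS-⊕ (suc j) f g = ≈-trans (⊖-cong (sgnS-⊕ j f g)) (≈-sym (FPSₚ.-‿+-comm (sgnS j f) (sgnS j g)))

sgnS-⊗ʳ : ∀ j f g → sgnS j (f ⊗ g) ≈ f ⊗ sgnS j g
sgnS-⊗ʳ zero    f g = ≈-refl
sgnS-⊗ʳ (suc j) f g = ≈-trans (⊖-cong (sgnS-⊗ʳ j f g)) (FPSₚ.-‿distribʳ-* f (sgnS j g))

sgnS-⊖ : ∀ j f → sgnS j (⊖ f) ≈ ⊖ sgnS j f
sgnS-⊖ zero    f = ≈-refl
sgnS-⊖ (suc j) f = ⊖-cong (sgnS-⊖ j f)

sgnS-sum : ∀ j {n} (h : Fin n → FPS) → sgnS j (sum h) ≈ sum (λ i → sgnS j (h i))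
sgnS-sum j {zero}  h = sgnS-zeroS j
  where
  sgnS-zeroS : ∀ j → sgnS j zeroS ≈ zeroS
  sgnS-zeroS zero    = ≈-refl
  sgnS-zeroS (suc j) = ≈-trans (⊖-cong (sgnS-zeroS j)) FPSₚ.-0#≈0#
sgnS-sum j {suc n} h = ≈-trans (sgnS-⊕ j (h zero) (sum (h ∘ suc))) (⊕-cong (≈-refl {sgnS j (h zero)}) (sgnS-sum j (h ∘ suc)))

det-cong : ∀ n {M M′ : Mat n} → (∀ i j → M i j ≈ M′ i j) → det n M ≈ det n M′
det-cong zero    p = ≈-refl
det-cong (suc n) {M} {M′} p =
  ≈-trans (det-laplace n M)
    (≈-trans (sum-cong-≋ (λ j → sgnS-cong (toℕ j) (⊗-cong (p zero j) (det-cong n (λ r c → p (suc r) (punchIn j c))))))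
             (≈-sym (det-laplace n M′)))

det-additive-by-terms : ∀ n (M A B : Mat (suc n)) → (∀ j → laplaceTerm M j ≈ laplaceTerm A j ⊕ laplaceTerm B j) →
                        det (suc n) M ≈ det (suc n) A ⊕ det (suc n) B
det-additive-by-terms n M A B p =
  ≈-trans (det-laplace n M)
    (≈-trans (sum-cong-≋ p)
      (≈-trans (∑-distrib-+ (laplaceTerm A) (laplaceTerm B))
               (⊕-cong (≈-sym (det-laplace n A)) (≈-sym (det-laplace n B)))))

det-row-additive : ∀ n (r : Fin n) (M A B : Mat n) →
  (∀ i j → i ≢ r → A i j ≈ M i j) → (∀ i j → i ≢ r → B i j ≈ M i j) → (∀ j → M r j ≈ A r j ⊕ B r j) →
  det n M ≈ det n A ⊕ det n B
det-row-additive (suc n) zero M A B pA pB pr = det-additive-by-terms n M A B λ j →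
  ≈-trans (sgnS-cong (toℕ j)
            (≈-trans (⊗-congʳ (det n (minor M j)) (pr j))
            (≈-trans (FPS.distribʳ (det n (minor M j)) (A zero j) (B zero j))
                     (⊕-cong (⊗-congˡ (A zero j) (det-cong n λ r c → ≈-sym (pA (suc r) (punchIn j c) λ ())))
                             (⊗-congˡ (B zero j) (det-cong n λ r c → ≈-sym (pB (suc r) (punchIn j c) λ ())))))))
          (sgnS-⊕ (toℕ j) _ _)
det-row-additive (suc n) (suc r) M A B pA pB pr = det-additive-by-terms n M A B λ j →
  ≈-trans (sgnS-cong (toℕ j)
            (≈-trans (⊗-congˡ (M zero j) (det-row-additive n r (minor M j) (minor A j) (minor B j)
                                       (λ i c ne → pA (suc i) (punchIn j c) (ne ∘ FP.suc-injective))
                                       (λ i c ne → pB (suc i) (punchIn j c) (ne ∘ FP.suc-injective))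
                                       (λ c → pr (punchIn j c))))
            (≈-trans (FPS.distribˡ (M zero j) (det n (minor A j)) (det n (minor B j)))
                     (⊕-cong (⊗-congʳ (det n (minor A j)) (≈-sym (pA zero j λ ()))) (⊗-congʳ (det n (minor B j)) (≈-sym (pB zero j λ ())))))))
          (sgnS-⊕ (toℕ j) _ _)

Vanish≤ : ℕ → FPS → Set
Vanish≤ k f = ∀ i → i ℕ.≤ k → f i ≡ 0ℚ

Vanish≤-cong : ∀ k {f g} → f ≈ g → Vanish≤ k f → Vanish≤ k g
Vanish≤-cong k p v i i≤k = trans (sym (coeff p i)) (v i i≤k)

Vanish≤-⊗ˡ : ∀ k f g → Vanish≤ k f → Vanish≤ k (f ⊗ g)
Vanish≤-⊗ˡ k f g v i i≤k = trans (⊗-coeff f g i) (Σ<-zero (suc i) _ λ a a≤i →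
  trans (cong (ℚ._* g (i ∸ a)) (v a (ℕP.≤-trans (ℕP.≤-pred a≤i) i≤k))) (ℚP.*-zeroˡ (g (i ∸ a))))

Vanish≤-⊗ʳ : ∀ k f g → Vanish≤ k g → Vanish≤ k (f ⊗ g)
Vanish≤-⊗ʳ k f g v = Vanish≤-cong k (⊗-comm g f) (Vanish≤-⊗ˡ k g f v)

Vanish≤-sgnS : ∀ k j f → Vanish≤ k f → Vanish≤ k (sgnS j f)
Vanish≤-sgnS k zero    f v = v
Vanish≤-sgnS k (suc j) f v i i≤k = cong ℚ.-_ (Vanish≤-sgnS k j f v i i≤k)

Vanish≤-sum : ∀ k {n} (h : Fin n → FPS) → (∀ j → Vanish≤ k (h j)) → Vanish≤ k (sum h)
Vanish≤-sum k {zero}  h v i _   = refl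
Vanish≤-sum k {suc n} h v i i≤k = cong₂ ℚ._+_ (v zero i i≤k) (Vanish≤-sum k (h ∘ suc) (v ∘ suc) i i≤k)

det-vanish-by-terms : ∀ k n (M : Mat (suc n)) → (∀ j → Vanish≤ k (M zero j ⊗ det n (minor M j))) →
                      Vanish≤ k (det (suc n) M)
det-vanish-by-terms k n M v = Vanish≤-cong k (≈-sym (det-laplace n M))
  (Vanish≤-sum k (laplaceTerm M) λ j → Vanish≤-sgnS k (toℕ j) _ (v j))

det-vanish-row : ∀ k n (M : Mat n) r → (∀ j → Vanish≤ k (M r j)) → Vanish≤ k (det n M)
det-vanish-row k (suc n) M zero    v = det-vanish-by-terms k n M λ j → Vanish≤-⊗ˡ k (M zero j) _ (v j)
det-vanish-row k (suc n) M (suc r) v = det-vanish-by-terms k n M λ j →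
  Vanish≤-⊗ʳ k (M zero j) _ (det-vanish-row k n (minor M j) r (λ c → v (punchIn j c)))

det-vanish-col : ∀ k n (M : Mat n) c → (∀ i → Vanish≤ k (M i c)) → Vanish≤ k (det n M)
det-vanish-col k (suc n) M c v = det-vanish-by-terms k n M term
  where
  term : ∀ j → Vanish≤ k (M zero j ⊗ det n (minor M j))
  term j with j F.≟ c
  ... | yes refl = Vanish≤-⊗ˡ k (M zero j) _ (v zero)
  ... | no j≢c   = Vanish≤-⊗ʳ k (M zero j) _ (det-vanish-col k n (minor M j) (punchOut j≢c)
                     λ i → subst (λ z → Vanish≤ k (M (suc i) z)) (sym (FP.punchIn-punchOut j≢c)) (v (suc i)))

-- Differentiation

ι : ℕ → ℚ
ι n = n ×ℚ 1ℚ

ι-+ : ∀ a b → ι (a ℕ.+ b) ≡ ι a ℚ.+ ι b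
ι-+ = ×-homo-+ 1ℚ

ι-* : ∀ a b → ι (a ℕ.* b) ≡ ι a ℚ.* ι b
ι-* = ×1-homo-*

∂ : FPS → FPS
∂ f k = ι (suc k) ℚ.* f (suc k)

∂-cong : ∀ {f g} → f ≈ g → ∂ f ≈ ∂ g
∂-cong p = mk≈ λ k → cong (ι (suc k) ℚ.*_) (coeff p (suc k))

∂-⊕ : ∀ f g → ∂ (f ⊕ g) ≈ ∂ f ⊕ ∂ g
∂-⊕ f g = mk≈ λ k → ℚP.*-distribˡ-+ (ι (suc k)) (f (suc k)) (g (suc k))

∂-sgnS : ∀ j f → ∂ (sgnS j f) ≈ sgnS j (∂ f)
∂-sgnS zero    f = ≈-refl
∂-sgnS (suc j) f = mk≈ λ k → trans (sym (ℚP.neg-distribʳ-* (ι (suc k)) (sgnS j f (suc k)))) (cong ℚ.-_ (coeff (∂-sgnS j f) k))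

∂-sum : ∀ {n} (h : Fin n → FPS) → ∂ (sum h) ≈ sum (λ i → ∂ (h i))
∂-sum {zero}  h = mk≈ λ k → ℚP.*-zeroʳ (ι (suc k))
∂-sum {suc n} h = ≈-trans (∂-⊕ (h zero) (sum (h ∘ suc))) (⊕-cong (≈-refl {∂ (h zero)}) (∂-sum (h ∘ suc)))

∂-oneS : ∂ oneS ≈ zeroS
∂-oneS = mk≈ λ k → ℚP.*-zeroʳ (ι (suc k))

-- Splitting the weight ι (k+1) = ι i + ι (k+1-i) in each term of the Cauchy product.
∂-⊗ : ∀ f g → ∂ (f ⊗ g) ≈ (∂ f ⊗ g) ⊕ (f ⊗ ∂ g)
∂-⊗ f g = mk≈ leibniz
  where
  leibniz : ∀ k → ∂ (f ⊗ g) k ≡ (∂ f ⊗ g) k ℚ.+ (f ⊗ ∂ g) k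
  leibniz k = begin
    ι (suc k) ℚ.* (f ⊗ g) (suc k)                          ≡⟨ cong (ι (suc k) ℚ.*_) (⊗-coeff f g (suc k)) ⟩
    ι (suc k) ℚ.* Σ< n (λ i → f i ℚ.* g (suc k ∸ i))        ≡⟨ *-distribˡ-Σ< n (ι (suc k)) (λ i → f i ℚ.* g (suc k ∸ i)) ⟨
    Σ< n (λ i → ι (suc k) ℚ.* (f i ℚ.* g (suc k ∸ i)))      ≡⟨ Σ<-cong n (λ i i<n → splitWeight i (ℕP.≤-pred i<n)) ⟩
    Σ< n (λ i → A i ℚ.+ B i)                                ≡⟨ Σ<-distrib-+ n A B ⟩
    Σ< n A ℚ.+ Σ< n B                                       ≡⟨ cong₂ ℚ._+_ ΣA ΣB ⟩
    (∂ f ⊗ g) k ℚ.+ (f ⊗ ∂ g) k                             ∎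
    where
    open ≡-Reasoning
    n = suc (suc k)
    A B : ℕ → ℚ
    A i = ι i ℚ.* (f i ℚ.* g (suc k ∸ i))
    B i = ι (suc k ∸ i) ℚ.* (f i ℚ.* g (suc k ∸ i))
    splitWeight : ∀ i → i ℕ.≤ suc k → ι (suc k) ℚ.* (f i ℚ.* g (suc k ∸ i)) ≡ A i ℚ.+ B i
    splitWeight i i≤k+1 =
      trans (cong (ℚ._* (f i ℚ.* g (suc k ∸ i))) (trans (cong ι (sym (ℕP.m+[n∸m]≡n i≤k+1))) (ι-+ i (suc k ∸ i))))
            (ℚP.*-distribʳ-+ (f i ℚ.* g (suc k ∸ i)) (ι i) (ι (suc k ∸ i)))
    swap : ∀ x y z → x ℚ.* (y ℚ.* z) ≡ y ℚ.* (x ℚ.* z)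
    swap = solve-∀ ℚ-ring
    ΣA : Σ< n A ≡ (∂ f ⊗ g) k
    ΣA = begin
      A 0 ℚ.+ Σ< (suc k) (A ∘ suc)               ≡⟨ cong (ℚ._+ Σ< (suc k) (A ∘ suc)) (ℚP.*-zeroˡ (f 0 ℚ.* g (suc k))) ⟩
      0ℚ ℚ.+ Σ< (suc k) (A ∘ suc)                ≡⟨ ℚP.+-identityˡ _ ⟩
      Σ< (suc k) (A ∘ suc)                       ≡⟨ Σ<-cong (suc k) (λ i _ → sym (ℚP.*-assoc (ι (suc i)) (f (suc i)) (g (k ∸ i)))) ⟩
      Σ< (suc k) (λ i → ∂ f i ℚ.* g (k ∸ i))      ≡⟨ ⊗-coeff (∂ f) g k ⟨
      (∂ f ⊗ g) k                                ∎
    ΣB : Σ< n B ≡ (f ⊗ ∂ g) k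
    ΣB = begin
      Σ< n B                                     ≡⟨ Σ<-snoc (suc k) B ⟩
      Σ< (suc k) B ℚ.+ B (suc k)                 ≡⟨ cong (Σ< (suc k) B ℚ.+_) (trans (cong (λ z → ι z ℚ.* (f (suc k) ℚ.* g z)) (ℕP.n∸n≡0 (suc k)))
                                                                               (ℚP.*-zeroˡ (f (suc k) ℚ.* g 0))) ⟩
      Σ< (suc k) B ℚ.+ 0ℚ                        ≡⟨ ℚP.+-identityʳ _ ⟩
      Σ< (suc k) B                               ≡⟨ Σ<-cong (suc k) (λ i i≤k → trans (cong (λ z → ι z ℚ.* (f i ℚ.* g z)) (ℕP.+-∸-assoc 1 (ℕP.≤-pred i≤k)))
                                                                               (swap (ι (suc (k ∸ i))) (f i) (g (suc (k ∸ i))))) ⟩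
      Σ< (suc k) (λ i → f i ℚ.* ∂ g (k ∸ i))      ≡⟨ ⊗-coeff f (∂ g) k ⟨
      (f ⊗ ∂ g) k                                ∎

∂-det : ∀ n (M : Mat n) (N : Fin n → Mat n) →
  (∀ r i j → i ≢ r → N r i j ≈ M i j) → (∀ r j → N r r j ≈ ∂ (M r j)) →
  ∂ (det n M) ≈ sum (λ r → det n (N r))
∂-det zero    M N same diff = ∂-oneS
∂-det (suc n) M N same diff =
  ≈-trans (∂-cong (det-laplace n M))
  (≈-trans (∂-sum (laplaceTerm M))
  (≈-trans (sum-cong-≋ termwise)
  (≈-trans (∑-distrib-+ (laplaceTerm (N zero)) (λ j → sum (λ r → laplaceTerm (N (suc r)) j)))
           (⊕-cong (≈-sym (det-laplace n (N zero)))
                   (≈-trans (∑-comm (λ j r → laplaceTerm (N (suc r)) j))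
                            (sum-cong-≋ λ r → ≈-sym (det-laplace n (N (suc r)))))))))
  where
  termwise : ∀ j → ∂ (laplaceTerm M j) ≈ laplaceTerm (N zero) j ⊕ sum (λ r → laplaceTerm (N (suc r)) j)
  termwise j =
    ≈-trans (∂-sgnS (toℕ j) (M zero j ⊗ det n (minor M j)))
    (≈-trans (sgnS-cong (toℕ j) (∂-⊗ (M zero j) (det n (minor M j))))
    (≈-trans (sgnS-⊕ (toℕ j) (∂ (M zero j) ⊗ det n (minor M j)) (M zero j ⊗ ∂ (det n (minor M j))))
    (⊕-cong
      (sgnS-cong (toℕ j) (⊗-cong (≈-sym (diff zero j)) (det-cong n λ r c → ≈-sym (same zero (suc r) (punchIn j c) λ ()))))
      (≈-trans (sgnS-cong (toℕ j) (⊗-congˡ (M zero j)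
                 (∂-det n (minor M j) (λ r → minor (N (suc r)) j)
                        (λ r i c ne → same (suc r) (suc i) (punchIn j c) (ne ∘ FP.suc-injective))
                        (λ r c → diff (suc r) (punchIn j c)))))
      (≈-trans (sgnS-cong (toℕ j) (*-distribˡ-sum (M zero j) (λ r → det n (minor (N (suc r)) j))))
      (≈-trans (sgnS-sum (toℕ j) (λ r → M zero j ⊗ det n (minor (N (suc r)) j)))
               (sum-cong-≋ λ r → sgnS-cong (toℕ j) (⊗-congʳ (det n (minor (N (suc r)) j)) (≈-sym (same (suc r) zero j λ ()))))))))))

replaceRow : ∀ {n} → Mat n → Fin n → (Fin n → FPS) → Mat n
replaceRow M r R i with i F.≟ r
... | yes _ = R
... | no _  = M i

replaceRow-same : ∀ {n} (M : Mat n) r R j → replaceRow M r R r j ≈ R j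
replaceRow-same M r R j with r F.≟ r
... | yes _   = ≈-refl
... | no r≢r  = ⊥-elim (r≢r refl)

replaceRow-other : ∀ {n} (M : Mat n) r R i j → i ≢ r → replaceRow M r R i j ≈ M i j
replaceRow-other M r R i j i≢r with i F.≟ r
... | yes i≡r = ⊥-elim (i≢r i≡r)
... | no _    = ≈-refl

∂-det-split : ∀ n (M : Mat n) (A B : Fin n → Mat n) →
  (∀ r i j → i ≢ r → A r i j ≈ M i j) → (∀ r i j → i ≢ r → B r i j ≈ M i j) →
  (∀ r j → ∂ (M r j) ≈ A r r j ⊕ B r r j) →
  ∂ (det n M) ≈ sum (λ r → det n (A r) ⊕ det n (B r))
∂-det-split n M A B offA offB split =
  ≈-trans (∂-det n M N (λ r i j i≢r → replaceRow-other M r _ i j i≢r) (λ r j → replaceRow-same M r _ j))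
          (sum-cong-≋ λ r → det-row-additive n r (N r) (A r) (B r)
            (λ i j i≢r → ≈-trans (offA r i j i≢r) (≈-sym (replaceRow-other M r _ i j i≢r)))
            (λ i j i≢r → ≈-trans (offB r i j i≢r) (≈-sym (replaceRow-other M r _ i j i≢r)))
            (λ j → ≈-trans (replaceRow-same M r _ j) (split r j)))
  where
  N : Fin n → Mat n
  N r = replaceRow M r (λ j → ∂ (M r j))

⊖-involutive : ∀ f → ⊖ (⊖ f) ≈ f
⊖-involutive = FPSₚ.-‿involutive

sum-⊖ : ∀ {n} (h : Fin n → FPS) → sum (λ i → ⊖ h i) ≈ ⊖ sum h
sum-⊖ h = ≈-sym (sgnS-sum 1 h)

punchIn-punchOut-comm : ∀ {n} (j j′ : Fin (suc (suc n))) (j≢j′ : j ≢ j′) (j′≢j : j′ ≢ j) (x : Fin n) →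
  punchIn j (punchIn (punchOut j≢j′) x) ≡ punchIn j′ (punchIn (punchOut j′≢j) x)
punchIn-punchOut-comm zero    zero    j≢j′ _ x = ⊥-elim (j≢j′ refl)
punchIn-punchOut-comm zero    (suc b) _    _ x = refl
punchIn-punchOut-comm (suc a) zero    _    _ x = refl
punchIn-punchOut-comm {suc n} (suc a) (suc b) _ _ zero = refl
punchIn-punchOut-comm {suc n} (suc a) (suc b) j≢j′ j′≢j (suc x) =
  cong suc (punchIn-punchOut-comm a b (j≢j′ ∘ cong suc) (j′≢j ∘ cong suc) x)

sgnS-punchOut-anticomm : ∀ {n} (j j′ : Fin (suc (suc n))) (j≢j′ : j ≢ j′) (j′≢j : j′ ≢ j) f →
  sgnS (toℕ j) (sgnS (toℕ (punchOut j≢j′)) f) ≈ ⊖ sgnS (toℕ j′) (sgnS (toℕ (punchOut j′≢j)) f)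
sgnS-punchOut-anticomm zero zero j≢j′ _ f = ⊥-elim (j≢j′ refl)
sgnS-punchOut-anticomm zero (suc b) _ _ f = ≈-sym (⊖-involutive (sgnS (toℕ b) f))
sgnS-punchOut-anticomm (suc a) zero _ _ f = ≈-refl
sgnS-punchOut-anticomm {zero} (suc zero) (suc zero) j≢j′ _ f = ⊥-elim (j≢j′ refl)
sgnS-punchOut-anticomm {suc n} (suc a) (suc b) j≢j′ j′≢j f =
  ≈-trans (⊖-cong (sgnS-⊖ (toℕ a) _))
  (≈-trans (⊖-involutive _)
  (≈-trans (sgnS-punchOut-anticomm a b (j≢j′ ∘ cong suc) (j′≢j ∘ cong suc) f)
           (⊖-cong (≈-sym (≈-trans (⊖-cong (sgnS-⊖ (toℕ b) _)) (⊖-involutive _))))))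

swap₀₁ : ∀ {n} → Fin (suc (suc n)) → Fin (suc (suc n))
swap₀₁ zero          = suc zero
swap₀₁ (suc zero)    = zero
swap₀₁ (suc (suc i)) = suc (suc i)

-- Expanding along the first two rows writes det M as a sum over ordered pairs j ≠ j′ of columns
-- for rows 0 and 1; exchanging those rows exchanges j and j′, and the two signs differ by one.
module _ {n : ℕ} where

  twoRowTerm : Mat (suc (suc n)) → Fin (suc (suc n)) → Fin (suc n) → FPS
  twoRowTerm M j c = sgnS (toℕ j) (sgnS (toℕ c)
    (M zero j ⊗ (M (suc zero) (punchIn j c) ⊗ det n (λ r x → M (suc (suc r)) (punchIn j (punchIn c x))))))

  det-twoRows : ∀ M → det (suc (suc n)) M ≈ sum (λ j → sum (twoRowTerm M j))
  det-twoRows M = ≈-trans (det-laplace (suc n) M) (sum-cong-≋ λ j →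
    ≈-trans (sgnS-cong (toℕ j) (⊗-congˡ (M zero j) (det-laplace n (minor M j))))
    (≈-trans (sgnS-cong (toℕ j) (*-distribˡ-sum (M zero j) (laplaceTerm (minor M j))))
    (≈-trans (sgnS-sum (toℕ j) (λ c → M zero j ⊗ laplaceTerm (minor M j) c))
             (sum-cong-≋ λ c → sgnS-cong (toℕ j) (≈-sym (sgnS-⊗ʳ (toℕ c) (M zero j) (minor M j zero c ⊗ det n (minor (minor M j) c))))))))

  pairTerm : Mat (suc (suc n)) → (j j′ : Fin (suc (suc n))) → Dec (j ≡ j′) → FPS
  pairTerm M j j′ (yes _)   = zeroS
  pairTerm M j j′ (no j≢j′) = sgnS (toℕ j) (sgnS (toℕ (punchOut j≢j′))
    (M zero j ⊗ (M (suc zero) j′ ⊗ det n (λ r x → M (suc (suc r)) (punchIn j (punchIn (punchOut j≢j′) x))))))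

  sum-pairTerm : ∀ M j → sum (λ j′ → pairTerm M j j′ (j F.≟ j′)) ≈ sum (twoRowTerm M j)
  sum-pairTerm M j =
    ≈-trans (sum-remove {i = j} (λ j′ → pairTerm M j j′ (j F.≟ j′)))
    (≈-trans (⊕-cong (diagonal (j F.≟ j)) (sum-cong-≋ λ c → offDiagonal c (j F.≟ punchIn j c)))
             (FPS.+-identityˡ _))
    where
    diagonal : ∀ d → pairTerm M j j d ≈ zeroS
    diagonal (yes _)  = ≈-refl
    diagonal (no j≢j) = ⊥-elim (j≢j refl)
    offDiagonal : ∀ c d → pairTerm M j (punchIn j c) d ≈ twoRowTerm M j c
    offDiagonal c (yes j≡j′) = ⊥-elim (FP.punchInᵢ≢i j c (sym j≡j′))
    offDiagonal c (no j≢j′)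
      rewrite trans (FP.punchOut-cong j {i≢j = j≢j′} {i≢k = FP.punchInᵢ≢i j c ∘ sym} refl) (FP.punchOut-punchIn j {c})
      = ≈-refl

  pairTerm-swap₀₁ : ∀ M j j′ d d′ → pairTerm (M ∘ swap₀₁) j j′ d ≈ ⊖ pairTerm M j′ j d′
  pairTerm-swap₀₁ M j j′ (yes _)     (yes _)     = mk≈ λ k → refl
  pairTerm-swap₀₁ M j j′ (yes j≡j′)  (no j′≢j)   = ⊥-elim (j′≢j (sym j≡j′))
  pairTerm-swap₀₁ M j j′ (no j≢j′)   (yes j′≡j)  = ⊥-elim (j≢j′ (sym j′≡j))
  pairTerm-swap₀₁ M j j′ (no j≢j′)   (no j′≢j)   =
    ≈-trans (sgnS-cong (toℕ j) (sgnS-cong (toℕ (punchOut j≢j′))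
      (≈-trans (⊗-congˡ (M (suc zero) j) (⊗-congˡ (M zero j′) (det-cong n λ r x →
                  ≈-reflexive (cong (M (suc (suc r))) (punchIn-punchOut-comm j j′ j≢j′ j′≢j x)))))
               (exchange (M (suc zero) j) (M zero j′) _))))
    (sgnS-punchOut-anticomm j j′ j≢j′ j′≢j _)
    where
    exchange : ∀ a b c → a ⊗ (b ⊗ c) ≈ b ⊗ (a ⊗ c)
    exchange = solve-∀ FPS-ring

  det-swap₀₁ : ∀ M → det (suc (suc n)) (M ∘ swap₀₁) ≈ ⊖ det (suc (suc n)) M
  det-swap₀₁ M =
    ≈-trans (det-twoRows (M ∘ swap₀₁))
    (≈-trans (sum-cong-≋ λ j → ≈-sym (sum-pairTerm (M ∘ swap₀₁) j))
    (≈-trans (sum-cong-≋ λ j → sum-cong-≋ λ j′ → pairTerm-swap₀₁ M j j′ (j F.≟ j′) (j′ F.≟ j))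
    (≈-trans (sum-cong-≋ λ j → sum-⊖ (λ j′ → pairTerm M j′ j (j′ F.≟ j)))
    (≈-trans (sum-⊖ (λ j → sum (λ j′ → pairTerm M j′ j (j′ F.≟ j))))
    (⊖-cong (≈-trans (∑-comm (λ j j′ → pairTerm M j′ j (j′ F.≟ j)))
            (≈-trans (sum-cong-≋ λ j′ → sum-pairTerm M j′)
                     (≈-sym (det-twoRows M)))))))))

record RowsSwapped n (a b : Fin n) (M M′ : Mat n) : Set where
  constructor mkSwapped
  field
    row-a     : ∀ j → M′ a j ≈ M b j
    row-b     : ∀ j → M′ b j ≈ M a j
    row-other : ∀ i j → i ≢ a → i ≢ b → M′ i j ≈ M i j

swapRows : ∀ {n} → Mat n → Fin n → Fin n → Mat n
swapRows M a b i with i F.≟ a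
... | yes _ = M b
... | no _ with i F.≟ b
...   | yes _ = M a
...   | no _  = M i

swapRows-swapped : ∀ {n} (M : Mat n) a b → a ≢ b → RowsSwapped n a b M (swapRows M a b)
swapRows-swapped M a b a≢b = mkSwapped rowA rowB other
  where
  rowA : ∀ j → swapRows M a b a j ≈ M b j
  rowA j with a F.≟ a
  ... | yes _   = ≈-refl
  ... | no a≢a  = ⊥-elim (a≢a refl)
  rowB : ∀ j → swapRows M a b b j ≈ M a j
  rowB j with b F.≟ a
  ... | yes b≡a = ⊥-elim (a≢b (sym b≡a))
  ... | no _ with b F.≟ b
  ...   | yes _  = ≈-refl
  ...   | no b≢b = ⊥-elim (b≢b refl)
  other : ∀ i j → i ≢ a → i ≢ b → swapRows M a b i j ≈ M i j
  other i j i≢a i≢b with i F.≟ a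
  ... | yes i≡a = ⊥-elim (i≢a i≡a)
  ... | no _ with i F.≟ b
  ...   | yes i≡b = ⊥-elim (i≢b i≡b)
  ...   | no _    = ≈-refl

-- A transposition (0 b) with b ≥ 2 is handled as (0 1) ∘ (1 b) ∘ (0 1); the middle one fixes row 0.
mutual
  det-rowsSwapped : ∀ n (a b : Fin n) → a ≢ b → ∀ M M′ → RowsSwapped n a b M M′ → det n M′ ≈ ⊖ det n M
  det-rowsSwapped (suc n) zero    zero    a≢b = ⊥-elim (a≢b refl)
  det-rowsSwapped (suc n) zero    (suc b) _   = det-rowsSwapped-zero n b
  det-rowsSwapped (suc n) (suc a) zero    _   M M′ (mkSwapped rowA rowB other) =
    det-rowsSwapped-zero n a M M′ (mkSwapped rowB rowA λ i j i≢0 i≢a → other i j i≢a i≢0)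
  det-rowsSwapped (suc n) (suc a) (suc b) a≢b = det-rowsSwapped-suc n a b (a≢b ∘ cong suc)

  det-rowsSwapped-zero : ∀ n (b : Fin n) M M′ → RowsSwapped (suc n) zero (suc b) M M′ → det (suc n) M′ ≈ ⊖ det (suc n) M
  det-rowsSwapped-zero (suc n) zero M M′ (mkSwapped rowA rowB other) =
    ≈-trans (det-cong (suc (suc n)) {M′} {M ∘ swap₀₁} M′≈M∘swap) (det-swap₀₁ M)
    where
    M′≈M∘swap : ∀ i j → M′ i j ≈ M (swap₀₁ i) j
    M′≈M∘swap zero          j = rowA j
    M′≈M∘swap (suc zero)    j = rowB j
    M′≈M∘swap (suc (suc i)) j = other (suc (suc i)) j (λ ()) (λ ())
  det-rowsSwapped-zero (suc n) (suc b) M M′ (mkSwapped rowA rowB other) =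
    ≈-sym (≈-trans (⊖-cong detM) (≈-trans (⊖-involutive (det N M₂))
          (≈-trans (det-rowsSwapped-suc (suc n) zero (suc b) (λ ()) M₁ M₂ (swapRows-swapped M₁ (suc zero) (suc (suc b)) (λ ())))
          (≈-trans (⊖-cong (det-swap₀₁ M′)) (⊖-involutive (det N M′))))))
    where
    N = suc (suc n)
    M₁ M₂ : Mat N
    M₁ = M′ ∘ swap₀₁
    M₂ = swapRows M₁ (suc zero) (suc (suc b))
    open RowsSwapped (swapRows-swapped M₁ (suc zero) (suc (suc b)) (λ ()))
      renaming (row-a to M₂-rowA; row-b to M₂-rowB; row-other to M₂-other)
    M≈M₂∘swap : ∀ i j → M i j ≈ M₂ (swap₀₁ i) j
    M≈M₂∘swap zero       j = ≈-trans (≈-sym (rowB j)) (≈-sym (M₂-rowA j))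
    M≈M₂∘swap (suc zero) j = ≈-trans (≈-sym (other (suc zero) j (λ ()) (λ ()))) (≈-sym (M₂-other zero j (λ ()) (λ ())))
    M≈M₂∘swap (suc (suc i)) j = lowerRow i j (i F.≟ b)
      where
      lowerRow : ∀ i j → Dec (i ≡ b) → M (suc (suc i)) j ≈ M₂ (suc (suc i)) j
      lowerRow i j (yes refl) = ≈-trans (≈-sym (rowA j)) (≈-sym (M₂-rowB j))
      lowerRow i j (no i≢b)   = ≈-trans (≈-sym (other (suc (suc i)) j (λ ()) i+2≢b+2)) (≈-sym (M₂-other (suc (suc i)) j (λ ()) i+2≢b+2))
        where
        i+2≢b+2 : suc (suc i) ≢ suc (suc b)
        i+2≢b+2 = i≢b ∘ FP.suc-injective ∘ FP.suc-injective
    detM : det N M ≈ ⊖ det N M₂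
    detM = ≈-trans (det-cong N {M} {M₂ ∘ swap₀₁} M≈M₂∘swap) (det-swap₀₁ M₂)

  det-rowsSwapped-suc : ∀ n (a b : Fin n) → a ≢ b → ∀ M M′ → RowsSwapped (suc n) (suc a) (suc b) M M′ →
                        det (suc n) M′ ≈ ⊖ det (suc n) M
  det-rowsSwapped-suc n a b a≢b M M′ (mkSwapped rowA rowB other) =
    ≈-trans (det-laplace n M′)
    (≈-trans (sum-cong-≋ λ j →
               ≈-trans (sgnS-cong (toℕ j) (⊗-cong (other zero j (λ ()) (λ ()))
                         (det-rowsSwapped n a b a≢b (minor M j) (minor M′ j)
                           (mkSwapped (λ c → rowA (punchIn j c)) (λ c → rowB (punchIn j c))
                              (λ i c i≢a i≢b → other (suc i) (punchIn j c) (i≢a ∘ FP.suc-injective) (i≢b ∘ FP.suc-injective))))))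
               (≈-trans (sgnS-cong (toℕ j) (≈-sym (FPSₚ.-‿distribʳ-* (M zero j) (det n (minor M j)))))
                        (sgnS-⊖ (toℕ j) (M zero j ⊗ det n (minor M j)))))
    (≈-trans (sum-⊖ (laplaceTerm M)) (⊖-cong (≈-sym (det-laplace n M)))))

recip : (d : ℕ) → .{{_ : ℕ.NonZero d}} → ℚ
recip d = + 1 ℚ./ d

recip-cong : ∀ {d d′} .{{_ : ℕ.NonZero d}} .{{_ : ℕ.NonZero d′}} → d ≡ d′ → recip d ≡ recip d′
recip-cong refl = refl

ι≡/1 : ∀ d → ι d ≡ + d ℚ./ 1
ι≡/1 zero    = refl
ι≡/1 (suc d) = trans (cong (1ℚ ℚ.+_) (ι≡/1 d)) (ℚP.toℚᵘ-injective (begin-equality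
  ℚ.toℚᵘ (1ℚ ℚ.+ + d ℚ./ 1)                   ≃⟨ ℚP.toℚᵘ-homo-+ 1ℚ (+ d ℚ./ 1) ⟩
  ℚ.toℚᵘ 1ℚ ℚᵘ.+ ℚ.toℚᵘ (+ d ℚ./ 1)            ≃⟨ ℚᵘP.+-cong (ℚP.toℚᵘ-fromℚᵘ (mkℚᵘ (+ 1) 0)) (ℚP.toℚᵘ-fromℚᵘ (mkℚᵘ (+ d) 0)) ⟩
  mkℚᵘ (+ 1) 0 ℚᵘ.+ mkℚᵘ (+ d) 0              ≃⟨ *≡* crossMultiplied ⟩
  mkℚᵘ (+ suc d) 0                            ≃⟨ ℚP.toℚᵘ-fromℚᵘ (mkℚᵘ (+ suc d) 0) ⟨
  ℚ.toℚᵘ (+ suc d ℚ./ 1)                      ∎))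
  where
  open ℚᵘP.≤-Reasoning
  normalise : ∀ x → (+ 1 ℤ.* + 1 ℤ.+ x ℤ.* + 1) ℤ.* + 1 ≡ (+ 1 ℤ.+ x) ℤ.* + 1
  normalise = ℤ-Solver.solve-∀
  crossMultiplied : (+ 1 ℤ.* + 1 ℤ.+ + d ℤ.* + 1) ℤ.* + 1 ≡ + suc d ℤ.* + 1
  crossMultiplied = trans (normalise (+ d)) (cong (ℤ._* + 1) (sym (ℤP.pos-+ 1 d)))

/-*-ι : ∀ x d .{{_ : ℕ.NonZero d}} → (+ x ℚ./ d) ℚ.* ι d ≡ ι x
/-*-ι x (suc d) = trans (cong ((+ x ℚ./ suc d) ℚ.*_) (ι≡/1 (suc d))) (trans cancelDenominator (sym (ι≡/1 x)))
  where
  open ℚᵘP.≤-Reasoning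
  cancelDenominator : (+ x ℚ./ suc d) ℚ.* (+ suc d ℚ./ 1) ≡ + x ℚ./ 1
  cancelDenominator = ℚP.toℚᵘ-injective (begin-equality
    ℚ.toℚᵘ ((+ x ℚ./ suc d) ℚ.* (+ suc d ℚ./ 1))    ≃⟨ ℚP.toℚᵘ-homo-* (+ x ℚ./ suc d) (+ suc d ℚ./ 1) ⟩
    ℚ.toℚᵘ (+ x ℚ./ suc d) ℚᵘ.* ℚ.toℚᵘ (+ suc d ℚ./ 1)
      ≃⟨ ℚᵘP.*-cong (ℚP.toℚᵘ-fromℚᵘ (mkℚᵘ (+ x) d)) (ℚP.toℚᵘ-fromℚᵘ (mkℚᵘ (+ suc d) 0)) ⟩
    mkℚᵘ (+ x) d ℚᵘ.* mkℚᵘ (+ suc d) 0             ≃⟨ *≡* crossMultiplied ⟩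
    mkℚᵘ (+ x) 0                                   ≃⟨ ℚP.toℚᵘ-fromℚᵘ (mkℚᵘ (+ x) 0) ⟨
    ℚ.toℚᵘ (+ x ℚ./ 1)                             ∎)
    where
    crossMultiplied : (+ x ℤ.* + suc d) ℤ.* + 1 ≡ + x ℤ.* + suc (ℕ.pred (suc d ℕ.* 1))
    crossMultiplied rewrite ℕP.*-identityʳ d = ℤP.*-identityʳ (+ x ℤ.* + suc d)

recip-ι : ∀ d .{{_ : ℕ.NonZero d}} → recip d ℚ.* ι d ≡ 1ℚ
recip-ι d = /-*-ι 1 d

recip-* : ∀ x y .{{_ : ℕ.NonZero x}} .{{_ : ℕ.NonZero y}} → recip (x ℕ.* y) {{ℕP.m*n≢0 x y}} ≡ recip x ℚ.* recip y
recip-* x y = begin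
  R                                                  ≡⟨ ℚP.*-identityʳ R ⟨
  R ℚ.* 1ℚ                                           ≡⟨ cong (R ℚ.*_) (trans (cong₂ ℚ._*_ (recip-ι x) (recip-ι y)) (ℚP.*-identityˡ 1ℚ)) ⟨
  R ℚ.* ((recip x ℚ.* ι x) ℚ.* (recip y ℚ.* ι y))    ≡⟨ regroup R (recip x) (ι x) (recip y) (ι y) ⟩
  (R ℚ.* (ι x ℚ.* ι y)) ℚ.* (recip x ℚ.* recip y)    ≡⟨ cong (λ z → (R ℚ.* z) ℚ.* (recip x ℚ.* recip y)) (ι-* x y) ⟨
  (R ℚ.* ι (x ℕ.* y)) ℚ.* (recip x ℚ.* recip y)      ≡⟨ cong (ℚ._* (recip x ℚ.* recip y)) (recip-ι (x ℕ.* y) {{ℕP.m*n≢0 x y}}) ⟩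
  1ℚ ℚ.* (recip x ℚ.* recip y)                       ≡⟨ ℚP.*-identityˡ _ ⟩
  recip x ℚ.* recip y                                ∎
  where
  open ≡-Reasoning
  R = recip (x ℕ.* y) {{ℕP.m*n≢0 x y}}
  regroup : ∀ a b c d e → a ℚ.* ((b ℚ.* c) ℚ.* (d ℚ.* e)) ≡ (a ℚ.* (c ℚ.* e)) ℚ.* (b ℚ.* d)
  regroup = solve-∀ ℚ-ring

*-ι-cancelʳ : ∀ x y d .{{_ : ℕ.NonZero d}} → x ℚ.* ι d ≡ y ℚ.* ι d → x ≡ y
*-ι-cancelʳ x y d eq = begin
  x                                ≡⟨ ℚP.*-identityʳ x ⟨
  x ℚ.* 1ℚ                         ≡⟨ cong (x ℚ.*_) ι*recip≡1 ⟨
  x ℚ.* (ι d ℚ.* recip d)          ≡⟨ ℚP.*-assoc x (ι d) (recip d) ⟨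
  (x ℚ.* ι d) ℚ.* recip d          ≡⟨ cong (ℚ._* recip d) eq ⟩
  (y ℚ.* ι d) ℚ.* recip d          ≡⟨ ℚP.*-assoc y (ι d) (recip d) ⟩
  y ℚ.* (ι d ℚ.* recip d)          ≡⟨ cong (y ℚ.*_) ι*recip≡1 ⟩
  y ℚ.* 1ℚ                         ≡⟨ ℚP.*-identityʳ y ⟩
  y                                ∎
  where
  open ≡-Reasoning
  ι*recip≡1 : ι d ℚ.* recip d ≡ 1ℚ
  ι*recip≡1 = trans (ℚP.*-comm (ι d) (recip d)) (recip-ι d)

recip-factorials : ℕ → ℕ → ℚ
recip-factorials a b = recip (a ! ℕ.* b !) {{a !* b !≢0}}

ι-suc*recip-factorials : ∀ a b → ι (suc a) ℚ.* recip-factorials (suc a) b ≡ recip-factorials a b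
ι-suc*recip-factorials a b = begin
  ι (suc a) ℚ.* recip (suc a ! ℕ.* b !) {{suc a !* b !≢0}}
    ≡⟨ cong (ι (suc a) ℚ.*_) (trans (recip-* (suc a !) (b !) {{suc a !≢0}} {{b !≢0}})
                                   (cong (ℚ._* recip (b !) {{b !≢0}}) (recip-* (suc a) (a !) {{_}} {{a !≢0}}))) ⟩
  ι (suc a) ℚ.* ((recip (suc a) ℚ.* recip (a !) {{a !≢0}}) ℚ.* recip (b !) {{b !≢0}})
    ≡⟨ regroup (ι (suc a)) (recip (suc a)) (recip (a !) {{a !≢0}}) (recip (b !) {{b !≢0}}) ⟩
  (recip (suc a) ℚ.* ι (suc a)) ℚ.* (recip (a !) {{a !≢0}} ℚ.* recip (b !) {{b !≢0}})
    ≡⟨ cong₂ ℚ._*_ (recip-ι (suc a)) (sym (recip-* (a !) (b !) {{a !≢0}} {{b !≢0}})) ⟩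
  1ℚ ℚ.* recip-factorials a b
    ≡⟨ ℚP.*-identityˡ _ ⟩
  recip-factorials a b ∎
  where
  open ≡-Reasoning
  regroup : ∀ u x p q → u ℚ.* ((x ℚ.* p) ℚ.* q) ≡ (x ℚ.* u) ℚ.* (p ℚ.* q)
  regroup = solve-∀ ℚ-ring

-- Coefficients of the modified Bessel functions

besselI2x-Σ< : ∀ ν k → besselI2x ν k ≡ Σ< (suc k) (besselTerm ν k)
besselI2x-Σ< ν k = sumℚ-map-upTo (suc k) (besselTerm ν k)

besselTerm-hit : ∀ ν k t → + (2 ℕ.* t) ℤ.+ ν ≡ + k → + 0 ℤ.≤ + t ℤ.+ ν →
                 besselTerm ν k t ≡ recip-factorials t ℤ.∣ + t ℤ.+ ν ∣
besselTerm-hit ν k t degree≡k nonNeg with + (2 ℕ.* t) ℤ.+ ν ℤ.≟ + k | + 0 ℤ.≤? + t ℤ.+ ν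
... | yes _ | yes _ = refl
... | no ≢k | _     = ⊥-elim (≢k degree≡k)
... | yes _ | no ≰  = ⊥-elim (≰ nonNeg)

besselTerm-miss : ∀ ν k t → (+ (2 ℕ.* t) ℤ.+ ν ≡ + k → + 0 ℤ.≤ + t ℤ.+ ν → ⊥) → besselTerm ν k t ≡ 0ℚ
besselTerm-miss ν k t miss with + (2 ℕ.* t) ℤ.+ ν ℤ.≟ + k | + 0 ℤ.≤? + t ℤ.+ ν
... | yes degree≡k | yes nonNeg = ⊥-elim (miss degree≡k nonNeg)
... | no _         | _          = refl
... | yes _        | no _       = refl

+[2*t]≡t+t : ∀ t → + (2 ℕ.* t) ≡ + t ℤ.+ + t
+[2*t]≡t+t t = trans (cong (λ u → + (t ℕ.+ u)) (ℕP.+-identityʳ t)) (ℤP.pos-+ t t)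

-- The coefficient of x^k in I_ν(2x) comes from the term x^a/a! · x^b/b! with a + b = k and b - a = ν.
besselI2x-vanish : ∀ ν k → (∀ a b → a ℕ.+ b ≡ k → + b ℤ.- + a ≡ ν → ⊥) → besselI2x ν k ≡ 0ℚ
besselI2x-vanish ν k noSplit = trans (besselI2x-Σ< ν k) (Σ<-zero (suc k) (besselTerm ν k) λ t _ →
  besselTerm-miss ν k t λ degree≡k nonNeg → noSplit t ℤ.∣ + t ℤ.+ ν ∣ (sum≡k degree≡k nonNeg) (diff≡ν nonNeg))
  where
  sum≡k : ∀ {t} → + (2 ℕ.* t) ℤ.+ ν ≡ + k → + 0 ℤ.≤ + t ℤ.+ ν → t ℕ.+ ℤ.∣ + t ℤ.+ ν ∣ ≡ k
  sum≡k {t} degree≡k nonNeg = ℤP.+-injective (begin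
    + (t ℕ.+ ℤ.∣ + t ℤ.+ ν ∣)     ≡⟨ ℤP.pos-+ t _ ⟩
    + t ℤ.+ + ℤ.∣ + t ℤ.+ ν ∣     ≡⟨ cong (λ z → + t ℤ.+ z) (ℤP.0≤i⇒+∣i∣≡i nonNeg) ⟩
    + t ℤ.+ (+ t ℤ.+ ν)           ≡⟨ ℤP.+-assoc (+ t) (+ t) ν ⟨
    (+ t ℤ.+ + t) ℤ.+ ν           ≡⟨ cong (ℤ._+ ν) (+[2*t]≡t+t t) ⟨
    + (2 ℕ.* t) ℤ.+ ν             ≡⟨ degree≡k ⟩
    + k                           ∎)
    where open ≡-Reasoning
  cancel : ∀ x y → (x ℤ.+ y) ℤ.- x ≡ y
  cancel = ℤ-Solver.solve-∀
  diff≡ν : ∀ {t} → + 0 ℤ.≤ + t ℤ.+ ν → + ℤ.∣ + t ℤ.+ ν ∣ ℤ.- + t ≡ ν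
  diff≡ν {t} nonNeg = trans (cong (ℤ._- + t) (ℤP.0≤i⇒+∣i∣≡i nonNeg)) (cancel (+ t) ν)

besselI2x-belowOrder : ∀ ν k → k ℕ.< ℤ.∣ ν ∣ → besselI2x ν k ≡ 0ℚ
besselI2x-belowOrder ν k k<∣ν∣ = besselI2x-vanish ν k λ a b a+b≡k b-a≡ν →
  ℕP.<⇒≱ k<∣ν∣ (subst (λ z → ℤ.∣ z ∣ ℕ.≤ k) b-a≡ν
                  (subst (ℤ.∣ + b ℤ.- + a ∣ ℕ.≤_) (trans (ℕP.+-comm b a) a+b≡k) (ℤP.∣i-j∣≤∣i∣+∣j∣ (+ b) (+ a))))

besselI2x-coeff : ∀ a b → besselI2x (+ b ℤ.- + a) (a ℕ.+ b) ≡ recip-factorials a b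
besselI2x-coeff a b = begin
  besselI2x ν (a ℕ.+ b)                              ≡⟨ besselI2x-Σ< ν (a ℕ.+ b) ⟩
  Σ< (suc (a ℕ.+ b)) (besselTerm ν (a ℕ.+ b))        ≡⟨ Σ<-select (suc (a ℕ.+ b)) (besselTerm ν (a ℕ.+ b)) a (s≤s (ℕP.m≤m+n a b))
                                                          (λ t t≢a → besselTerm-miss ν (a ℕ.+ b) t λ degree≡ _ → t≢a (onlyA t degree≡)) ⟩
  besselTerm ν (a ℕ.+ b) a                           ≡⟨ besselTerm-hit ν (a ℕ.+ b) a degreeA (subst (+ 0 ℤ.≤_) (sym a+ν≡b) (ℤ.+≤+ z≤n)) ⟩
  recip-factorials a ℤ.∣ + a ℤ.+ ν ∣                  ≡⟨ cong (λ z → recip-factorials a ℤ.∣ z ∣) a+ν≡b ⟩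
  recip-factorials a b                               ∎
  where
  open ≡-Reasoning
  ν = + b ℤ.- + a
  expand : ∀ x y → x ℤ.+ x ℤ.+ (y ℤ.- x) ≡ x ℤ.+ y
  expand = ℤ-Solver.solve-∀
  cancel : ∀ x y → x ℤ.+ (y ℤ.- x) ≡ y
  cancel = ℤ-Solver.solve-∀
  degreeA : + (2 ℕ.* a) ℤ.+ ν ≡ + (a ℕ.+ b)
  degreeA = trans (cong (ℤ._+ ν) (+[2*t]≡t+t a)) (trans (expand (+ a) (+ b)) (sym (ℤP.pos-+ a b)))
  a+ν≡b : + a ℤ.+ ν ≡ + b
  a+ν≡b = cancel (+ a) (+ b)
  doubles : ∀ (x y z : ℤ) → x ℤ.+ x ℤ.+ (y ℤ.- z) ≡ z ℤ.+ y → x ℤ.+ x ≡ z ℤ.+ z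
  doubles x y z eq = trans (sym (shift x y z)) (trans (cong (λ q → q ℤ.- y ℤ.+ z) eq) (shift′ y z))
    where
    shift : ∀ x y z → x ℤ.+ x ℤ.+ (y ℤ.- z) ℤ.- y ℤ.+ z ≡ x ℤ.+ x
    shift = ℤ-Solver.solve-∀
    shift′ : ∀ y z → z ℤ.+ y ℤ.- y ℤ.+ z ≡ z ℤ.+ z
    shift′ = ℤ-Solver.solve-∀
  onlyA : ∀ t → + (2 ℕ.* t) ℤ.+ ν ≡ + (a ℕ.+ b) → t ≡ a
  onlyA t degree≡ = ℕP.*-cancelˡ-≡ t a 2 (ℤP.+-injective (trans (+[2*t]≡t+t t) (trans
    (doubles (+ t) (+ b) (+ a) (trans (cong (ℤ._+ ν) (sym (+[2*t]≡t+t t))) (trans degree≡ (ℤP.pos-+ a b))))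
    (sym (+[2*t]≡t+t a)))))

weight-a*recip-factorials : ∀ a b k → a ℕ.+ b ≡ suc k → ι a ℚ.* recip-factorials a b ≡ besselI2x ((+ b ℤ.- + a) ℤ.+ + 1) k
weight-a*recip-factorials zero b k b≡k+1 = begin
  0ℚ ℚ.* recip-factorials 0 b                ≡⟨ ℚP.*-zeroˡ (recip-factorials 0 b) ⟩
  0ℚ                                         ≡⟨ besselI2x-belowOrder ((+ b ℤ.- + 0) ℤ.+ + 1) k (subst (λ z → k ℕ.< ℤ.∣ z ∣) (sym ν+1≡k+2) (ℕP.m<n+m k (s≤s z≤n))) ⟨
  besselI2x ((+ b ℤ.- + 0) ℤ.+ + 1) k        ∎
  where
  open ≡-Reasoning
  ν+1≡k+2 : (+ b ℤ.- + 0) ℤ.+ + 1 ≡ + (2 ℕ.+ k)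
  ν+1≡k+2 rewrite b≡k+1 = normalise (+ k)
    where
    normalise : ∀ y → ((+ 1 ℤ.+ y) ℤ.- + 0) ℤ.+ + 1 ≡ + 2 ℤ.+ y
    normalise = ℤ-Solver.solve-∀
weight-a*recip-factorials (suc a) b k a+b≡k+1 = begin
  ι (suc a) ℚ.* recip-factorials (suc a) b   ≡⟨ ι-suc*recip-factorials a b ⟩
  recip-factorials a b                       ≡⟨ besselI2x-coeff a b ⟨
  besselI2x (+ b ℤ.- + a) (a ℕ.+ b)          ≡⟨ cong₂ besselI2x (sym (shift (+ a) (+ b))) (ℕP.suc-injective a+b≡k+1) ⟩
  besselI2x ((+ b ℤ.- + suc a) ℤ.+ + 1) k    ∎
  where
  open ≡-Reasoning
  shift : ∀ x y → (y ℤ.- (+ 1 ℤ.+ x)) ℤ.+ + 1 ≡ y ℤ.- x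
  shift = ℤ-Solver.solve-∀

recip-factorials-comm : ∀ a b → recip-factorials a b ≡ recip-factorials b a
recip-factorials-comm a b = recip-cong {{a !* b !≢0}} {{b !* a !≢0}} (ℕP.*-comm (a !) (b !))

weight-b*recip-factorials : ∀ a b k → a ℕ.+ b ≡ suc k → ι b ℚ.* recip-factorials a b ≡ besselI2x ((+ b ℤ.- + a) ℤ.- + 1) k
weight-b*recip-factorials a zero k a+0≡k+1 = begin
  0ℚ ℚ.* recip-factorials a 0                ≡⟨ ℚP.*-zeroˡ (recip-factorials a 0) ⟩
  0ℚ                                         ≡⟨ besselI2x-belowOrder ((+ 0 ℤ.- + a) ℤ.- + 1) k
                                                  (subst (λ z → k ℕ.< ℤ.∣ z ∣) (sym ν-1≡-[k+2]) (ℕP.m<n+m k (s≤s z≤n))) ⟨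
  besselI2x ((+ 0 ℤ.- + a) ℤ.- + 1) k        ∎
  where
  open ≡-Reasoning
  ν-1≡-[k+2] : (+ 0 ℤ.- + a) ℤ.- + 1 ≡ ℤ.- + (2 ℕ.+ k)
  ν-1≡-[k+2] rewrite trans (sym (ℕP.+-identityʳ a)) a+0≡k+1 = normalise (+ k)
    where
    normalise : ∀ y → (+ 0 ℤ.- (+ 1 ℤ.+ y)) ℤ.- + 1 ≡ ℤ.- (+ 2 ℤ.+ y)
    normalise = ℤ-Solver.solve-∀
weight-b*recip-factorials a (suc b) k a+b+1≡k+1 = begin
  ι (suc b) ℚ.* recip-factorials a (suc b)   ≡⟨ cong (ι (suc b) ℚ.*_) (recip-factorials-comm a (suc b)) ⟩
  ι (suc b) ℚ.* recip-factorials (suc b) a   ≡⟨ ι-suc*recip-factorials b a ⟩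
  recip-factorials b a                       ≡⟨ recip-factorials-comm b a ⟩
  recip-factorials a b                       ≡⟨ besselI2x-coeff a b ⟨
  besselI2x (+ b ℤ.- + a) (a ℕ.+ b)          ≡⟨ cong₂ besselI2x (sym (shift (+ a) (+ b))) (ℕP.suc-injective (trans (sym (ℕP.+-suc a b)) a+b+1≡k+1)) ⟩
  besselI2x ((+ suc b ℤ.- + a) ℤ.- + 1) k    ∎
  where
  open ≡-Reasoning
  shift : ∀ x y → ((+ 1 ℤ.+ y) ℤ.- x) ℤ.- + 1 ≡ y ℤ.- x
  shift = ℤ-Solver.solve-∀

BesselDerivativeAt : ℤ → ℕ → Set
BesselDerivativeAt ν k = ι (suc k) ℚ.* besselI2x ν (suc k) ≡ besselI2x (ν ℤ.- + 1) k ℚ.+ besselI2x (ν ℤ.+ + 1) k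

-- The weight a + b of 1/(a! b!) splits as a/(a! b!) + b/(a! b!).
besselI2x-derivative-split : ∀ a b k → a ℕ.+ b ≡ suc k → BesselDerivativeAt (+ b ℤ.- + a) k
besselI2x-derivative-split a b k a+b≡k+1 = begin
  ι (suc k) ℚ.* besselI2x (+ b ℤ.- + a) (suc k)
    ≡⟨ cong (λ n → ι n ℚ.* besselI2x (+ b ℤ.- + a) n) (sym a+b≡k+1) ⟩
  ι (a ℕ.+ b) ℚ.* besselI2x (+ b ℤ.- + a) (a ℕ.+ b)
    ≡⟨ cong₂ ℚ._*_ (ι-+ a b) (besselI2x-coeff a b) ⟩
  (ι a ℚ.+ ι b) ℚ.* recip-factorials a b
    ≡⟨ ℚP.*-distribʳ-+ (recip-factorials a b) (ι a) (ι b) ⟩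
  ι a ℚ.* recip-factorials a b ℚ.+ ι b ℚ.* recip-factorials a b
    ≡⟨ ℚP.+-comm (ι a ℚ.* recip-factorials a b) (ι b ℚ.* recip-factorials a b) ⟩
  ι b ℚ.* recip-factorials a b ℚ.+ ι a ℚ.* recip-factorials a b
    ≡⟨ cong₂ ℚ._+_ (weight-b*recip-factorials a b k a+b≡k+1) (weight-a*recip-factorials a b k a+b≡k+1) ⟩
  besselI2x ((+ b ℤ.- + a) ℤ.- + 1) k ℚ.+ besselI2x ((+ b ℤ.- + a) ℤ.+ + 1) k ∎
  where open ≡-Reasoning

besselI2x-derivative-noSplit : ∀ ν k → (∀ a b → a ℕ.+ b ≡ suc k → + b ℤ.- + a ≡ ν → ⊥) → BesselDerivativeAt ν k
besselI2x-derivative-noSplit ν k noSplit = begin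
  ι (suc k) ℚ.* besselI2x ν (suc k)                        ≡⟨ cong (ι (suc k) ℚ.*_) (besselI2x-vanish ν (suc k) noSplit) ⟩
  ι (suc k) ℚ.* 0ℚ                                         ≡⟨ ℚP.*-zeroʳ (ι (suc k)) ⟩
  0ℚ ℚ.+ 0ℚ                                                ≡⟨ cong₂ ℚ._+_ (besselI2x-vanish (ν ℤ.- + 1) k noSplitBelow)
                                                                          (besselI2x-vanish (ν ℤ.+ + 1) k noSplitAbove) ⟨
  besselI2x (ν ℤ.- + 1) k ℚ.+ besselI2x (ν ℤ.+ + 1) k       ∎
  where
  open ≡-Reasoning
  shiftB : ∀ x y → (x ℤ.+ + 1) ℤ.- y ≡ (x ℤ.- y) ℤ.+ + 1
  shiftB = ℤ-Solver.solve-∀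
  shiftA : ∀ x y → x ℤ.- (y ℤ.+ + 1) ≡ (x ℤ.- y) ℤ.- + 1
  shiftA = ℤ-Solver.solve-∀
  undo- : ∀ z → (z ℤ.- + 1) ℤ.+ + 1 ≡ z
  undo- = ℤ-Solver.solve-∀
  undo+ : ∀ z → (z ℤ.+ + 1) ℤ.- + 1 ≡ z
  undo+ = ℤ-Solver.solve-∀
  noSplitBelow : ∀ a b → a ℕ.+ b ≡ k → + b ℤ.- + a ≡ ν ℤ.- + 1 → ⊥
  noSplitBelow a b a+b≡k b-a≡ν-1 = noSplit a (suc b) (trans (ℕP.+-suc a b) (cong suc a+b≡k))
    (trans (cong (ℤ._- + a) (trans (cong +_ (ℕP.+-comm 1 b)) (ℤP.pos-+ b 1)))
           (trans (shiftB (+ b) (+ a)) (trans (cong (ℤ._+ + 1) b-a≡ν-1) (undo- ν))))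
  noSplitAbove : ∀ a b → a ℕ.+ b ≡ k → + b ℤ.- + a ≡ ν ℤ.+ + 1 → ⊥
  noSplitAbove a b a+b≡k b-a≡ν+1 = noSplit (suc a) b (cong suc a+b≡k)
    (trans (cong (λ z → + b ℤ.- z) (trans (cong +_ (ℕP.+-comm 1 a)) (ℤP.pos-+ a 1)))
           (trans (shiftA (+ b) (+ a)) (trans (cong (ℤ._- + 1) b-a≡ν+1) (undo+ ν))))

besselI2x-derivative : ∀ ν k → BesselDerivativeAt ν k
besselI2x-derivative ν k with FP.any? (λ (a : Fin (suc (suc k))) → + (suc k ∸ toℕ a) ℤ.- + toℕ a ℤ.≟ ν)
... | yes (a , b-a≡ν) = subst (λ ν → BesselDerivativeAt ν k) b-a≡ν
        (besselI2x-derivative-split (toℕ a) (suc k ∸ toℕ a) k (ℕP.m+[n∸m]≡n (ℕP.≤-pred (FP.toℕ<n a))))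
... | no noSplit = besselI2x-derivative-noSplit ν k λ a b a+b≡k+1 b-a≡ν →
        noSplit (F.fromℕ< (a<k+2 a b a+b≡k+1) , trans (splitAt a b a+b≡k+1) b-a≡ν)
  where
  a<k+2 : ∀ a b → a ℕ.+ b ≡ suc k → a ℕ.< suc (suc k)
  a<k+2 a b a+b≡k+1 = s≤s (subst (a ℕ.≤_) a+b≡k+1 (ℕP.m≤m+n a b))
  splitAt : ∀ a b (a+b≡k+1 : a ℕ.+ b ≡ suc k) → let i = toℕ (F.fromℕ< (a<k+2 a b a+b≡k+1)) in
            + (suc k ∸ i) ℤ.- + i ≡ + b ℤ.- + a
  splitAt a b a+b≡k+1 rewrite FP.toℕ-fromℕ< (a<k+2 a b a+b≡k+1) =
    cong (λ x → + x ℤ.- + a) (trans (cong (_∸ a) (sym a+b≡k+1)) (ℕP.m+n∸m≡n a b))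

private variable
  A B : Set

sumMap : (A → ℚ) → List A → ℚ
sumMap f xs = sumℚ (L.map f xs)

sumℚ-++ : ∀ xs ys → sumℚ (xs ++ ys) ≡ sumℚ xs ℚ.+ sumℚ ys
sumℚ-++ []       ys = sym (ℚP.+-identityˡ _)
sumℚ-++ (x ∷ xs) ys = trans (cong (x ℚ.+_) (sumℚ-++ xs ys)) (sym (ℚP.+-assoc x (sumℚ xs) (sumℚ ys)))

sumMap-cong : ∀ {f g : A → ℚ} xs → (∀ x → f x ≡ g x) → sumMap f xs ≡ sumMap g xs
sumMap-cong []       eq = refl
sumMap-cong (x ∷ xs) eq = cong₂ ℚ._+_ (eq x) (sumMap-cong xs eq)

sumMap-zero : ∀ (f : A → ℚ) xs → (∀ x → f x ≡ 0ℚ) → sumMap f xs ≡ 0ℚ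
sumMap-zero f []       eq = refl
sumMap-zero f (x ∷ xs) eq = cong₂ ℚ._+_ (eq x) (sumMap-zero f xs eq)

sumMap-distrib-+ : ∀ (f g : A → ℚ) xs → sumMap (λ x → f x ℚ.+ g x) xs ≡ sumMap f xs ℚ.+ sumMap g xs
sumMap-distrib-+ f g []       = refl
sumMap-distrib-+ f g (x ∷ xs) =
  trans (cong (f x ℚ.+ g x ℚ.+_) (sumMap-distrib-+ f g xs)) (interchange (f x) (g x) (sumMap f xs) (sumMap g xs))
  where
  interchange : ∀ a b c d → a ℚ.+ b ℚ.+ (c ℚ.+ d) ≡ a ℚ.+ c ℚ.+ (b ℚ.+ d)
  interchange = solve-∀ ℚ-ring

*-distribˡ-sumMap : ∀ c (f : A → ℚ) xs → sumMap (λ x → c ℚ.* f x) xs ≡ c ℚ.* sumMap f xs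
*-distribˡ-sumMap c f []       = sym (ℚP.*-zeroʳ c)
*-distribˡ-sumMap c f (x ∷ xs) =
  trans (cong (c ℚ.* f x ℚ.+_) (*-distribˡ-sumMap c f xs)) (sym (ℚP.*-distribˡ-+ c (f x) (sumMap f xs)))

*-distribʳ-sumMap : ∀ c (f : A → ℚ) xs → sumMap (λ x → f x ℚ.* c) xs ≡ sumMap f xs ℚ.* c
*-distribʳ-sumMap c f xs =
  trans (sumMap-cong xs (λ x → ℚP.*-comm (f x) c)) (trans (*-distribˡ-sumMap c f xs) (ℚP.*-comm c (sumMap f xs)))

sumMap-neg : ∀ (f : A → ℚ) xs → sumMap (λ x → ℚ.- f x) xs ≡ ℚ.- sumMap f xs
sumMap-neg f []       = refl
sumMap-neg f (x ∷ xs) = trans (cong (ℚ.- f x ℚ.+_) (sumMap-neg f xs)) (sym (ℚP.neg-distrib-+ (f x) (sumMap f xs)))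

sumMap-comm : ∀ (f : A → B → ℚ) xs (ys : List B) →
              sumMap (λ x → sumMap (f x) ys) xs ≡ sumMap (λ y → sumMap (λ x → f x y) xs) ys
sumMap-comm f []       ys = sym (sumMap-zero (λ _ → 0ℚ) ys (λ _ → refl))
sumMap-comm f (x ∷ xs) ys =
  trans (cong (sumMap (f x) ys ℚ.+_) (sumMap-comm f xs ys)) (sym (sumMap-distrib-+ (f x) (λ y → sumMap (λ x → f x y) xs) ys))

sumMap-map : ∀ (f : B → ℚ) (g : A → B) xs → sumMap f (L.map g xs) ≡ sumMap (f ∘ g) xs
sumMap-map f g xs = cong sumℚ (sym (LP.map-∘ xs))

sumMap-concatMap : ∀ (f : B → ℚ) (h : A → List B) xs →
                   sumMap f (concatMap h xs) ≡ sumMap (λ x → sumMap f (h x)) xs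
sumMap-concatMap f h []       = refl
sumMap-concatMap f h (x ∷ xs) =
  trans (cong sumℚ (LP.map-++ f (h x) (concatMap h xs)))
        (trans (sumℚ-++ (L.map f (h x)) (L.map f (concatMap h xs))) (cong (sumMap f (h x) ℚ.+_) (sumMap-concatMap f h xs)))

rangeSum : ℕ → (ℤ → ℚ) → ℚ
rangeSum B h = sumMap h (rangeℤ B)

rangeSum-Σ< : ∀ B h → rangeSum B h ≡ Σ< (suc (2 ℕ.* B)) (λ i → h (+ i ℤ.- + B))
rangeSum-Σ< B h = trans (sumMap-map h (λ i → + i ℤ.- + B) (upTo (suc (2 ℕ.* B)))) (sumℚ-map-upTo (suc (2 ℕ.* B)) (λ i → h (+ i ℤ.- + B)))

+[2*B]≡B+B : ∀ B → + (2 ℕ.* B) ≡ + B ℤ.+ + B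
+[2*B]≡B+B B = trans (cong (λ u → + (B ℕ.+ u)) (ℕP.+-identityʳ B)) (ℤP.pos-+ B B)

rangeSum-suc : ∀ B h → rangeSum (suc B) h ≡ h -[1+ B ] ℚ.+ (rangeSum B h ℚ.+ h (+ suc B))
rangeSum-suc B h = begin
  rangeSum (suc B) h                                                    ≡⟨ rangeSum-Σ< (suc B) h ⟩
  Σ< (suc (2 ℕ.* suc B)) g                                              ≡⟨ cong (λ z → Σ< (suc z) g) (ℕP.*-suc 2 B) ⟩
  g 0 ℚ.+ Σ< (suc (suc (2 ℕ.* B))) (g ∘ suc)                            ≡⟨ cong (g 0 ℚ.+_) (Σ<-snoc (suc (2 ℕ.* B)) (g ∘ suc)) ⟩
  g 0 ℚ.+ (Σ< (suc (2 ℕ.* B)) (g ∘ suc) ℚ.+ g (suc (suc (2 ℕ.* B))))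
    ≡⟨ cong₂ (λ a b → h -[1+ B ] ℚ.+ (a ℚ.+ h b)) (Σ<-cong (suc (2 ℕ.* B)) (λ i _ → cong h (inner i))) top ⟩
  h -[1+ B ] ℚ.+ (Σ< (suc (2 ℕ.* B)) (λ i → h (+ i ℤ.- + B)) ℚ.+ h (+ suc B))
    ≡⟨ cong (λ a → h -[1+ B ] ℚ.+ (a ℚ.+ h (+ suc B))) (rangeSum-Σ< B h) ⟨
  h -[1+ B ] ℚ.+ (rangeSum B h ℚ.+ h (+ suc B))                          ∎
  where
  open ≡-Reasoning
  g = λ i → h (+ i ℤ.- + suc B)
  shift : ∀ i b → (+ 1 ℤ.+ i) ℤ.- (+ 1 ℤ.+ b) ≡ i ℤ.- b
  shift = ℤ-Solver.solve-∀
  inner : ∀ i → + suc i ℤ.- + suc B ≡ + i ℤ.- + B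
  inner i = shift (+ i) (+ B)
  normalise : ∀ b → (+ 2 ℤ.+ (b ℤ.+ b)) ℤ.- (+ 1 ℤ.+ b) ≡ + 1 ℤ.+ b
  normalise = ℤ-Solver.solve-∀
  top : + suc (suc (2 ℕ.* B)) ℤ.- + suc B ≡ + suc B
  top = trans (cong (λ z → + 2 ℤ.+ z ℤ.- + suc B) (+[2*B]≡B+B B)) (normalise (+ B))

rangeSum-cong : ∀ B {h g} → (∀ x → h x ≡ g x) → rangeSum B h ≡ rangeSum B g
rangeSum-cong B = sumMap-cong (rangeℤ B)

rangeSum-extend : ∀ N d h → (∀ x → N ℕ.< ℤ.∣ x ∣ → h x ≡ 0ℚ) → rangeSum (d ℕ.+ N) h ≡ rangeSum N h
rangeSum-extend N zero    h outside = refl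
rangeSum-extend N (suc d) h outside =
  trans (rangeSum-suc (d ℕ.+ N) h)
  (trans (cong₂ (λ a b → a ℚ.+ (rangeSum (d ℕ.+ N) h ℚ.+ b)) (outside _ (s≤s (ℕP.m≤n+m N d))) (outside _ (s≤s (ℕP.m≤n+m N d))))
  (trans (ℚP.+-identityˡ _) (trans (ℚP.+-identityʳ _) (rangeSum-extend N d h outside))))

rangeSum-shift+ : ∀ B h → h (ℤ.- + B) ≡ 0ℚ → h (+ suc B) ≡ 0ℚ → rangeSum B (λ x → h (x ℤ.+ + 1)) ≡ rangeSum B h
rangeSum-shift+ B h h[-B]≡0 h[B+1]≡0 = begin
  rangeSum B (λ x → h (x ℤ.+ + 1))                               ≡⟨ rangeSum-Σ< B (λ x → h (x ℤ.+ + 1)) ⟩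
  Σ< (suc (2 ℕ.* B)) (λ i → h ((+ i ℤ.- + B) ℤ.+ + 1))            ≡⟨ Σ<-snoc (2 ℕ.* B) (λ i → h ((+ i ℤ.- + B) ℤ.+ + 1)) ⟩
  Σ< (2 ℕ.* B) (λ i → h ((+ i ℤ.- + B) ℤ.+ + 1)) ℚ.+ h ((+ (2 ℕ.* B) ℤ.- + B) ℤ.+ + 1)
    ≡⟨ cong₂ ℚ._+_ (Σ<-cong (2 ℕ.* B) (λ i _ → cong h (step (+ i) (+ B)))) (trans (cong h top) h[B+1]≡0) ⟩
  Σ< (2 ℕ.* B) (λ i → h (+ suc i ℤ.- + B)) ℚ.+ 0ℚ               ≡⟨ ℚP.+-identityʳ _ ⟩
  Σ< (2 ℕ.* B) (λ i → h (+ suc i ℤ.- + B))                      ≡⟨ ℚP.+-identityˡ _ ⟨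
  0ℚ ℚ.+ Σ< (2 ℕ.* B) (λ i → h (+ suc i ℤ.- + B))               ≡⟨ cong (ℚ._+ Σ< (2 ℕ.* B) (λ i → h (+ suc i ℤ.- + B)))
                                                                       (trans (cong h (ℤP.+-identityˡ (ℤ.- + B))) h[-B]≡0) ⟨
  h (+ 0 ℤ.- + B) ℚ.+ Σ< (2 ℕ.* B) (λ i → h (+ suc i ℤ.- + B))  ≡⟨ rangeSum-Σ< B h ⟨
  rangeSum B h                                                  ∎
  where
  open ≡-Reasoning
  step : ∀ i b → (i ℤ.- b) ℤ.+ + 1 ≡ (+ 1 ℤ.+ i) ℤ.- b
  step = ℤ-Solver.solve-∀
  normalise : ∀ b → ((b ℤ.+ b) ℤ.- b) ℤ.+ + 1 ≡ + 1 ℤ.+ b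
  normalise = ℤ-Solver.solve-∀
  top : (+ (2 ℕ.* B) ℤ.- + B) ℤ.+ + 1 ≡ + suc B
  top = trans (cong (λ z → (z ℤ.- + B) ℤ.+ + 1) (+[2*B]≡B+B B)) (normalise (+ B))

rangeSum-shift- : ∀ B h → h -[1+ B ] ≡ 0ℚ → h (+ B) ≡ 0ℚ → rangeSum B (λ x → h (x ℤ.- + 1)) ≡ rangeSum B h
rangeSum-shift- B h h[-B-1]≡0 h[B]≡0 = sym (trans (rangeSum-cong B (λ x → cong h (sym (undo x))))
  (rangeSum-shift+ B (λ x → h (x ℤ.- + 1)) (trans (cong h (bottom (+ B))) h[-B-1]≡0) (trans (cong h (undo′ (+ B))) h[B]≡0)))
  where
  undo : ∀ x → (x ℤ.+ + 1) ℤ.- + 1 ≡ x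
  undo = ℤ-Solver.solve-∀
  undo′ : ∀ b → (+ 1 ℤ.+ b) ℤ.- + 1 ≡ b
  undo′ = ℤ-Solver.solve-∀
  bottom : ∀ b → ℤ.- b ℤ.- + 1 ≡ ℤ.- (+ 1 ℤ.+ b)
  bottom = ℤ-Solver.solve-∀

boxSum : ∀ n → List ℤ → (Vec ℤ n → ℚ) → ℚ
boxSum n xs G = sumMap G (vecsOver n xs)

boxSum-suc : ∀ n xs G → boxSum (suc n) xs G ≡ sumMap (λ x → boxSum n xs (λ v → G (x V.∷ v))) xs
boxSum-suc n xs G = trans (sumMap-concatMap G (λ x → L.map (x V.∷_) (vecsOver n xs)) xs)
                          (sumMap-cong xs (λ x → sumMap-map G (x V.∷_) (vecsOver n xs)))

boxSum-cong : ∀ n xs {G G′} → (∀ v → G v ≡ G′ v) → boxSum n xs G ≡ boxSum n xs G′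
boxSum-cong n xs = sumMap-cong (vecsOver n xs)

boxSum-zero : ∀ n xs G → (∀ v → G v ≡ 0ℚ) → boxSum n xs G ≡ 0ℚ
boxSum-zero n xs G = sumMap-zero G (vecsOver n xs)

boxSum-singleton : ∀ n x G → boxSum n (x ∷ []) G ≡ G (V.replicate n x)
boxSum-singleton zero    x G = ℚP.+-identityʳ _
boxSum-singleton (suc n) x G =
  trans (boxSum-suc n (x ∷ []) G) (trans (ℚP.+-identityʳ _) (boxSum-singleton n x (λ v → G (x V.∷ v))))

SupportedIn : ∀ {n} → ℕ → (Vec ℤ n → ℚ) → Set
SupportedIn {n} N G = ∀ v (i : Fin n) → N ℕ.< ℤ.∣ lookup v i ∣ → G v ≡ 0ℚ

SupportedIn-tail : ∀ {n} N (G : Vec ℤ (suc n) → ℚ) x → SupportedIn N G → SupportedIn N (λ v → G (x V.∷ v))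
SupportedIn-tail N G x supp v i = supp (x V.∷ v) (suc i)

boxSum-extend : ∀ n N d G → SupportedIn N G → boxSum n (rangeℤ (d ℕ.+ N)) G ≡ boxSum n (rangeℤ N) G
boxSum-extend zero    N d G supp = refl
boxSum-extend (suc n) N d G supp = begin
  boxSum (suc n) (rangeℤ (d ℕ.+ N)) G
    ≡⟨ boxSum-suc n _ G ⟩
  rangeSum (d ℕ.+ N) (λ x → boxSum n (rangeℤ (d ℕ.+ N)) (λ v → G (x V.∷ v)))
    ≡⟨ rangeSum-cong (d ℕ.+ N) (λ x → boxSum-extend n N d _ (SupportedIn-tail N G x supp)) ⟩
  rangeSum (d ℕ.+ N) (λ x → boxSum n (rangeℤ N) (λ v → G (x V.∷ v)))
    ≡⟨ rangeSum-extend N d _ (λ x N<∣x∣ → boxSum-zero n _ _ (λ v → supp (x V.∷ v) zero N<∣x∣)) ⟩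
  rangeSum N (λ x → boxSum n (rangeℤ N) (λ v → G (x V.∷ v)))
    ≡⟨ boxSum-suc n _ G ⟨
  boxSum (suc n) (rangeℤ N) G ∎
  where open ≡-Reasoning

boxSum-stable : ∀ n N B G → SupportedIn N G → N ℕ.≤ B → boxSum n (rangeℤ B) G ≡ boxSum n (rangeℤ N) G
boxSum-stable n N B G supp N≤B =
  trans (cong (λ z → boxSum n (rangeℤ z) G) (sym (ℕP.m∸n+n≡m N≤B))) (boxSum-extend n N (B ∸ N) G supp)

boxSum-shift+ : ∀ n (r : Fin n) N B G → SupportedIn N G → N ℕ.< B →
                boxSum n (rangeℤ B) (λ v → G (updateAt v r (ℤ._+ + 1))) ≡ boxSum n (rangeℤ B) G
boxSum-shift+ (suc n) zero N B G supp N<B = trans (boxSum-suc n _ _) (trans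
  (rangeSum-shift+ B (λ x → boxSum n (rangeℤ B) (λ v → G (x V.∷ v)))
     (boxSum-zero n _ _ (λ v → supp _ zero (subst (N ℕ.<_) (sym (ℤP.∣-i∣≡∣i∣ (+ B))) N<B)))
     (boxSum-zero n _ _ (λ v → supp _ zero (ℕP.m<n⇒m<1+n N<B))))
  (sym (boxSum-suc n _ G)))
boxSum-shift+ (suc n) (suc r) N B G supp N<B = trans (boxSum-suc n _ _) (trans
  (rangeSum-cong B (λ x → boxSum-shift+ n r N B (λ v → G (x V.∷ v)) (SupportedIn-tail N G x supp) N<B))
  (sym (boxSum-suc n _ G)))

boxSum-shift- : ∀ n (r : Fin n) N B G → SupportedIn N G → N ℕ.< B →
                boxSum n (rangeℤ B) (λ v → G (updateAt v r (ℤ._- + 1))) ≡ boxSum n (rangeℤ B) G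
boxSum-shift- (suc n) zero N B G supp N<B = trans (boxSum-suc n _ _) (trans
  (rangeSum-shift- B (λ x → boxSum n (rangeℤ B) (λ v → G (x V.∷ v)))
     (boxSum-zero n _ _ (λ v → supp _ zero (ℕP.m<n⇒m<1+n N<B)))
     (boxSum-zero n _ _ (λ v → supp _ zero N<B)))
  (sym (boxSum-suc n _ G)))
boxSum-shift- (suc n) (suc r) N B G supp N<B = trans (boxSum-suc n _ _) (trans
  (rangeSum-cong B (λ x → boxSum-shift- n r N B (λ v → G (x V.∷ v)) (SupportedIn-tail N G x supp) N<B))
  (sym (boxSum-suc n _ G)))

swapAt : ∀ {n} → Fin n → Fin n → Vec ℤ n → Vec ℤ n
swapAt a b v = updateAt (updateAt v a (λ _ → lookup v b)) b (λ _ → lookup v a)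

-- As for determinants, the transposition (0 b+1) with b ≥ 1 is conjugated to (1 b+1) by (0 1).
mutual
  boxSum-swap : ∀ n (a b : Fin n) xs G → boxSum n xs (λ v → G (swapAt a b v)) ≡ boxSum n xs G
  boxSum-swap (suc n) zero    zero    xs G = boxSum-cong (suc n) xs (λ { (x V.∷ v) → refl })
  boxSum-swap (suc n) zero    (suc b) xs G = boxSum-swap-zero n b xs G
  boxSum-swap (suc n) (suc a) zero    xs G =
    trans (boxSum-cong (suc n) xs (λ { (x V.∷ v) → refl })) (boxSum-swap-zero n a xs G)
  boxSum-swap (suc n) (suc a) (suc b) xs G =
    trans (boxSum-suc n xs _) (trans (sumMap-cong xs (λ x → boxSum-swap n a b xs (λ v → G (x V.∷ v)))) (sym (boxSum-suc n xs G)))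

  boxSum-swap-zero : ∀ n (b : Fin n) xs G → boxSum (suc n) xs (λ v → G (swapAt zero (suc b) v)) ≡ boxSum (suc n) xs G
  boxSum-swap-zero (suc n) zero xs G =
    trans (boxSum-suc (suc n) xs _)
    (trans (sumMap-cong xs (λ x → boxSum-suc n xs _))
    (trans (sumMap-comm (λ x y → boxSum n xs (λ w → G (y V.∷ x V.∷ w))) xs xs)
    (trans (sumMap-cong xs (λ y → sym (boxSum-suc n xs (λ v → G (y V.∷ v)))))
           (sym (boxSum-suc (suc n) xs G)))))
  boxSum-swap-zero (suc n) (suc b) xs G =
    trans (boxSum-cong (suc (suc n)) xs (λ { (x V.∷ y V.∷ w) → refl }))
    (trans (boxSum-swap-zero (suc n) zero xs (λ v → G (swapAt zero (suc zero) (swapAt (suc zero) (suc (suc b)) v))))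
    (trans (trans (boxSum-suc (suc n) xs _)
                  (trans (sumMap-cong xs (λ x → boxSum-swap-zero n b xs (λ v → G (swapAt zero (suc zero) (x V.∷ v)))))
                         (sym (boxSum-suc (suc n) xs (λ v → G (swapAt zero (suc zero) v))))))
           (boxSum-swap-zero (suc n) zero xs G)))

sumS-coeff : ∀ (fs : List FPS) k → sumS fs k ≡ sumMap (λ f → f k) fs
sumS-coeff []       k = refl
sumS-coeff (f ∷ fs) k = cong (f k ℚ.+_) (sumS-coeff fs k)

sum-coeff : ∀ {n} (h : Fin n → FPS) k → sum h k ≡ sumMap (λ i → h i k) (allFin n)
sum-coeff {n} h k = trans (cong (λ f → f k) (sym (sumS-map-allFin n h)))
                          (trans (sumS-coeff (L.map h (allFin n)) k) (sumMap-map (λ f → f k) h (allFin n)))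

sumMap-allSteps : ∀ n (g : Step n → ℚ) → sumMap g (allSteps n) ≡ sumMap (λ i → g (i , true) ℚ.+ g (i , false)) (allFin n)
sumMap-allSteps n g = trans (sumMap-concatMap g (λ i → (i , true) ∷ (i , false) ∷ []) (allFin n))
  (sumMap-cong (allFin n) (λ i → cong (g (i , true) ℚ.+_) (ℚP.+-identityʳ (g (i , false)))))

ifᵈ_then_ : ∀ {P : Set} → Dec P → ℚ → ℚ
ifᵈ yes _ then q = q
ifᵈ no _  then q = 0ℚ

sumMap-filter : ∀ {P : Pred A 0ℓ} (P? : Decidable P) (f : A → ℚ) xs →
                sumMap f (filter P? xs) ≡ sumMap (λ x → ifᵈ P? x then f x) xs
sumMap-filter P? f []       = refl
sumMap-filter P? f (x ∷ xs) with P? x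
... | yes _ = cong (f x ℚ.+_) (sumMap-filter P? f xs)
... | no _  = trans (sumMap-filter P? f xs) (sym (ℚP.+-identityˡ _))

module _ {P : Set} where

  *-ifᵈ : ∀ (d : Dec P) c q → c ℚ.* (ifᵈ d then q) ≡ ifᵈ d then (c ℚ.* q)
  *-ifᵈ (yes _) c q = refl
  *-ifᵈ (no _)  c q = ℚP.*-zeroʳ c

  ifᵈ-sumMap : ∀ (d : Dec P) (f : A → ℚ) xs → ifᵈ d then sumMap f xs ≡ sumMap (λ x → ifᵈ d then f x) xs
  ifᵈ-sumMap (yes _) f xs = refl
  ifᵈ-sumMap (no _)  f xs = sym (sumMap-zero (λ _ → 0ℚ) xs (λ _ → refl))

  ifᵈ-neg : ∀ (d : Dec P) q → ifᵈ d then (ℚ.- q) ≡ ℚ.- (ifᵈ d then q)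
  ifᵈ-neg (yes _) q = refl
  ifᵈ-neg (no _)  q = refl

  ifᵈ-zero : ∀ (d : Dec P) q → (P → q ≡ 0ℚ) → ifᵈ d then q ≡ 0ℚ
  ifᵈ-zero (yes p) q q≡0 = q≡0 p
  ifᵈ-zero (no _)  q q≡0 = refl

  ifᵈ-yes : ∀ (d : Dec P) q → P → ifᵈ d then q ≡ q
  ifᵈ-yes (yes _) q p = refl
  ifᵈ-yes (no ¬p) q p = ⊥-elim (¬p p)

  ifᵈ-cong : ∀ {Q : Set} (d : Dec P) (d′ : Dec Q) → (P → Q) → (Q → P) → ∀ q → ifᵈ d then q ≡ ifᵈ d′ then q
  ifᵈ-cong (yes _) (yes _) _   _   q = refl
  ifᵈ-cong (yes p) (no ¬q) P→Q _   q = ⊥-elim (¬q (P→Q p))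
  ifᵈ-cong (no ¬p) (yes q) _   Q→P _ = ⊥-elim (¬p (Q→P q))
  ifᵈ-cong (no _)  (no _)  _   _   q = refl

x≡-x⇒x≡0 : ∀ x → x ≡ ℚ.- x → x ≡ 0ℚ
x≡-x⇒x≡0 x x≡-x = begin
  x                          ≡⟨ halve x ⟩
  ℚ.½ ℚ.* (x ℚ.+ x)          ≡⟨ cong (λ z → ℚ.½ ℚ.* (x ℚ.+ z)) x≡-x ⟩
  ℚ.½ ℚ.* (x ℚ.+ ℚ.- x)      ≡⟨ cong (ℚ.½ ℚ.*_) (ℚP.+-inverseʳ x) ⟩
  ℚ.½ ℚ.* 0ℚ                 ≡⟨ ℚP.*-zeroʳ ℚ.½ ⟩
  0ℚ                         ∎
  where
  open ≡-Reasoning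
  distribute : ∀ h y → (h ℚ.+ h) ℚ.* y ≡ h ℚ.* (y ℚ.+ y)
  distribute = solve-∀ ℚ-ring
  halve : ∀ y → y ≡ ℚ.½ ℚ.* (y ℚ.+ y)
  halve y = trans (sym (ℚP.*-identityˡ y)) (distribute ℚ.½ y)

sumℤ-updateAt : ∀ {n} (v : Vec ℤ n) r f → sumℤ (updateAt v r f) ≡ sumℤ v ℤ.- lookup v r ℤ.+ f (lookup v r)
sumℤ-updateAt (x V.∷ v) zero    f = rearrange (f x) x (sumℤ v)
  where
  rearrange : ∀ a b c → a ℤ.+ c ≡ b ℤ.+ c ℤ.- b ℤ.+ a
  rearrange = ℤ-Solver.solve-∀
sumℤ-updateAt (x V.∷ v) (suc r) f =
  trans (cong (λ z → x ℤ.+ z) (sumℤ-updateAt v r f)) (rearrange x (sumℤ v) (lookup v r) (f (lookup v r)))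
  where
  rearrange : ∀ a b c d → a ℤ.+ (b ℤ.- c ℤ.+ d) ≡ a ℤ.+ b ℤ.- c ℤ.+ d
  rearrange = ℤ-Solver.solve-∀

lookup-swapAt-a : ∀ {n} (v : Vec ℤ n) a b → a ≢ b → lookup (swapAt a b v) a ≡ lookup v b
lookup-swapAt-a v a b a≢b = trans (VP.lookup∘updateAt′ a b a≢b (updateAt v a _)) (VP.lookup∘updateAt a v)

lookup-swapAt-b : ∀ {n} (v : Vec ℤ n) a b → lookup (swapAt a b v) b ≡ lookup v a
lookup-swapAt-b v a b = VP.lookup∘updateAt b (updateAt v a _)

lookup-swapAt-other : ∀ {n} (v : Vec ℤ n) a b i → i ≢ a → i ≢ b → lookup (swapAt a b v) i ≡ lookup v i
lookup-swapAt-other v a b i i≢a i≢b = trans (VP.lookup∘updateAt′ i b i≢b (updateAt v a _)) (VP.lookup∘updateAt′ i a i≢a v)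

sumℤ-swapAt : ∀ {n} (v : Vec ℤ n) a b → a ≢ b → sumℤ (swapAt a b v) ≡ sumℤ v
sumℤ-swapAt v a b a≢b = trans (sumℤ-updateAt (updateAt v a _) b _) (trans
  (cong₂ (λ x y → x ℤ.- y ℤ.+ lookup v a) (sumℤ-updateAt v a _) (VP.lookup∘updateAt′ b a (a≢b ∘ sym) v))
  (cancel (sumℤ v) (lookup v a) (lookup v b)))
  where
  cancel : ∀ x a b → x ℤ.- a ℤ.+ b ℤ.- b ℤ.+ a ≡ x
  cancel = ℤ-Solver.solve-∀

‖_‖₁ : ∀ {n} → Vec ℤ n → ℕ
‖ V.[]     ‖₁ = 0
‖ x V.∷ v ‖₁ = ℤ.∣ x ∣ ℕ.+ ‖ v ‖₁

∣lookup∣≤‖‖₁ : ∀ {n} (v : Vec ℤ n) i → ℤ.∣ lookup v i ∣ ℕ.≤ ‖ v ‖₁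
∣lookup∣≤‖‖₁ (x V.∷ v) zero    = ℕP.m≤m+n _ _
∣lookup∣≤‖‖₁ (x V.∷ v) (suc i) = ℕP.≤-trans (∣lookup∣≤‖‖₁ v i) (ℕP.m≤n+m _ _)

‖updateAt‖₁ : ∀ {n} (v : Vec ℤ n) r f → (∀ x → ℤ.∣ f x ∣ ℕ.≤ suc ℤ.∣ x ∣) → ‖ updateAt v r f ‖₁ ℕ.≤ suc ‖ v ‖₁
‖updateAt‖₁ (x V.∷ v) zero    f bound = ℕP.+-monoˡ-≤ ‖ v ‖₁ (bound x)
‖updateAt‖₁ (x V.∷ v) (suc r) f bound =
  ℕP.≤-trans (ℕP.+-monoʳ-≤ ℤ.∣ x ∣ (‖updateAt‖₁ v r f bound)) (ℕP.≤-reflexive (ℕP.+-suc ℤ.∣ x ∣ ‖ v ‖₁))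

‖move‖₁ : ∀ {n} (v : Vec ℤ n) s → ‖ move v s ‖₁ ℕ.≤ suc ‖ v ‖₁
‖move‖₁ v (r , true)  = ‖updateAt‖₁ v r (ℤ._+ + 1) λ x →
  ℕP.≤-trans (ℤP.∣i+j∣≤∣i∣+∣j∣ x (+ 1)) (ℕP.≤-reflexive (ℕP.+-comm ℤ.∣ x ∣ 1))
‖move‖₁ v (r , false) = ‖updateAt‖₁ v r (ℤ._- + 1) λ x →
  ℕP.≤-trans (ℤP.∣i-j∣≤∣i∣+∣j∣ x (+ 1)) (ℕP.≤-reflexive (ℕP.+-comm ℤ.∣ x ∣ 1))

-- Reflections and the alternating sum

∣t∣≤∣mt+a-b∣+∣a∣+∣b∣ : ∀ m t a b → 1 ℕ.≤ m → ℤ.∣ t ∣ ℕ.≤ ℤ.∣ + m ℤ.* t ℤ.+ a ℤ.- b ∣ ℕ.+ ℤ.∣ a ∣ ℕ.+ ℤ.∣ b ∣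
∣t∣≤∣mt+a-b∣+∣a∣+∣b∣ m t a b 1≤m = begin
  ℤ.∣ t ∣                                              ≤⟨ ℕP.m≤n*m ℤ.∣ t ∣ m ⟩
  m ℕ.* ℤ.∣ t ∣                                        ≡⟨ ℤP.abs-* (+ m) t ⟨
  ℤ.∣ + m ℤ.* t ∣                                      ≡⟨ cong ℤ.∣_∣ (unfold (+ m ℤ.* t) a b) ⟩
  ℤ.∣ (+ m ℤ.* t ℤ.+ a ℤ.- b) ℤ.- a ℤ.+ b ∣             ≤⟨ ℤP.∣i+j∣≤∣i∣+∣j∣ ((+ m ℤ.* t ℤ.+ a ℤ.- b) ℤ.- a) b ⟩
  ℤ.∣ (+ m ℤ.* t ℤ.+ a ℤ.- b) ℤ.- a ∣ ℕ.+ ℤ.∣ b ∣       ≤⟨ ℕP.+-monoˡ-≤ ℤ.∣ b ∣ (ℤP.∣i-j∣≤∣i∣+∣j∣ (+ m ℤ.* t ℤ.+ a ℤ.- b) a) ⟩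
  ℤ.∣ + m ℤ.* t ℤ.+ a ℤ.- b ∣ ℕ.+ ℤ.∣ a ∣ ℕ.+ ℤ.∣ b ∣   ∎
  where
  open ℕP.≤-Reasoning
  unfold : ∀ x a b → x ≡ (x ℤ.+ a ℤ.- b) ℤ.- a ℤ.+ b
  unfold = ℤ-Solver.solve-∀
  instance _ = ℕ.>-nonZero 1≤m

boxSum-antiInvariant : ∀ n xs (G : Vec ℤ n → ℚ) (φ : Vec ℤ n → Vec ℤ n) →
  boxSum n xs (G ∘ φ) ≡ boxSum n xs G → (∀ t → G (φ t) ≡ ℚ.- G t) → boxSum n xs G ≡ 0ℚ
boxSum-antiInvariant n xs G φ invariant anti =
  x≡-x⇒x≡0 (boxSum n xs G) (trans (sym invariant) (trans (boxSum-cong n xs anti) (sumMap-neg G (vecsOver n xs))))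

-- The reflection in the wall x_z - x_l = m, acting on the translation vector t.
affineSwap : ∀ {n} → Fin n → Fin n → Vec ℤ n → Vec ℤ n
affineSwap z l t = updateAt (updateAt (swapAt z l t) z (ℤ._+ + 1)) l (ℤ._- + 1)

module _ {n} (z l : Fin n) (z≢l : z ≢ l) (t : Vec ℤ n) where

  lookup-affineSwap-z : lookup (affineSwap z l t) z ≡ lookup t l ℤ.+ + 1
  lookup-affineSwap-z =
    trans (VP.lookup∘updateAt′ z l z≢l (updateAt (swapAt z l t) z (ℤ._+ + 1)))
          (trans (VP.lookup∘updateAt z (swapAt z l t)) (cong (ℤ._+ + 1) (lookup-swapAt-a t z l z≢l)))

  lookup-affineSwap-l : lookup (affineSwap z l t) l ≡ lookup t z ℤ.- + 1
  lookup-affineSwap-l =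
    trans (VP.lookup∘updateAt l (updateAt (swapAt z l t) z (ℤ._+ + 1)))
          (cong (ℤ._- + 1) (trans (VP.lookup∘updateAt′ l z (z≢l ∘ sym) (swapAt z l t)) (lookup-swapAt-b t z l)))

  lookup-affineSwap-other : ∀ i → i ≢ z → i ≢ l → lookup (affineSwap z l t) i ≡ lookup t i
  lookup-affineSwap-other i i≢z i≢l =
    trans (VP.lookup∘updateAt′ i l i≢l (updateAt (swapAt z l t) z (ℤ._+ + 1)))
          (trans (VP.lookup∘updateAt′ i z i≢z (swapAt z l t)) (lookup-swapAt-other t z l i i≢z i≢l))

  sumℤ-affineSwap : sumℤ (affineSwap z l t) ≡ sumℤ t
  sumℤ-affineSwap =
    trans (sumℤ-updateAt (updateAt (swapAt z l t) z (ℤ._+ + 1)) l (ℤ._- + 1))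
    (trans (cong (λ q → q ℤ.- y ℤ.+ (y ℤ.- + 1))
                 (trans (sumℤ-updateAt (swapAt z l t) z (ℤ._+ + 1)) (cong (λ q → q ℤ.- x ℤ.+ (x ℤ.+ + 1)) (sumℤ-swapAt t z l z≢l))))
           (cancel (sumℤ t) x y))
    where
    x = lookup (swapAt z l t) z
    y = lookup (updateAt (swapAt z l t) z (ℤ._+ + 1)) l
    cancel : ∀ S a b → (S ℤ.- a ℤ.+ (a ℤ.+ + 1)) ℤ.- b ℤ.+ (b ℤ.- + 1) ≡ S
    cancel = ℤ-Solver.solve-∀

boxSum-affineSwap : ∀ n (z l : Fin n) → z ≢ l → ∀ N B G → SupportedIn N G → suc (suc N) ℕ.≤ B →
                    boxSum n (rangeℤ B) (G ∘ affineSwap z l) ≡ boxSum n (rangeℤ B) G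
boxSum-affineSwap n z l z≢l N B G supp N+2≤B =
  trans (boxSum-swap n z l (rangeℤ B) (λ u → G′ (updateAt u z (ℤ._+ + 1))))
  (trans (boxSum-shift+ n z (suc N) B G′ supp′ N+2≤B)
         (boxSum-shift- n l N B G supp (ℕP.<-trans (ℕP.n<1+n N) N+2≤B)))
  where
  G′ : Vec ℤ n → ℚ
  G′ w = G (updateAt w l (ℤ._- + 1))
  ∣x∣≤∣x-1∣+1 : ∀ x → ℤ.∣ x ∣ ℕ.≤ ℤ.∣ x ℤ.- + 1 ∣ ℕ.+ 1
  ∣x∣≤∣x-1∣+1 x = subst (λ y → ℤ.∣ y ∣ ℕ.≤ ℤ.∣ x ℤ.- + 1 ∣ ℕ.+ 1) (undo x) (ℤP.∣i+j∣≤∣i∣+∣j∣ (x ℤ.- + 1) (+ 1))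
    where
    undo : ∀ x → (x ℤ.- + 1) ℤ.+ + 1 ≡ x
    undo = ℤ-Solver.solve-∀
  supp′ : SupportedIn (suc N) G′
  supp′ v i N+1<∣vᵢ∣ with i F.≟ l
  ... | yes refl = supp (updateAt v l (ℤ._- + 1)) l
        (subst (λ y → N ℕ.< ℤ.∣ y ∣) (sym (VP.lookup∘updateAt l v))
          (ℕP.≤-pred (subst (suc (suc N) ℕ.≤_) (ℕP.+-comm (ℤ.∣ lookup v l ℤ.- + 1 ∣) 1)
                               (ℕP.<-≤-trans N+1<∣vᵢ∣ (∣x∣≤∣x-1∣+1 (lookup v l))))))
  ... | no i≢l = supp (updateAt v l (ℤ._- + 1)) i
        (subst (λ y → N ℕ.< ℤ.∣ y ∣) (sym (VP.lookup∘updateAt′ i l i≢l v)) (ℕP.<-trans (ℕP.n<1+n N) N+1<∣vᵢ∣))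

module AlternatingSum (n m : ℕ) (λ' : Vec ℤ n) where

  entry : Vec ℤ n → Vec ℤ n → Fin n → Fin n → ℤ
  entry η t i j = + m ℤ.* lookup t i ℤ.+ lookup λ' j ℤ.- lookup η i

  besselMatrix : Vec ℤ n → Vec ℤ n → Mat n
  besselMatrix η t i j = besselI2x (entry η t i j)

  Det : Vec ℤ n → Vec ℤ n → FPS
  Det η t = detTerm n m η λ' t

  ∂-detTerm : ∀ η t → ∂ (Det η t) ≈ sum (λ r → Det (move η (r , true)) t ⊕ Det (move η (r , false)) t)
  ∂-detTerm η t = ∂-det-split n (besselMatrix η t)
    (λ r → besselMatrix (move η (r , true)) t) (λ r → besselMatrix (move η (r , false)) t)
    (λ r → offRow r) (λ r → offRow r) rowDerivative
    where
    offRow : ∀ {f} r i j → i ≢ r → besselMatrix (updateAt η r f) t i j ≈ besselMatrix η t i j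
    offRow r i j i≢r = ≈-reflexive (cong (λ y → besselI2x (+ m ℤ.* lookup t i ℤ.+ lookup λ' j ℤ.- y)) (VP.lookup∘updateAt′ i r i≢r η))
    shift+ : ∀ a b c → a ℤ.+ b ℤ.- (c ℤ.+ + 1) ≡ (a ℤ.+ b ℤ.- c) ℤ.- + 1
    shift+ = ℤ-Solver.solve-∀
    shift- : ∀ a b c → a ℤ.+ b ℤ.- (c ℤ.- + 1) ≡ (a ℤ.+ b ℤ.- c) ℤ.+ + 1
    shift- = ℤ-Solver.solve-∀
    entry-move : ∀ f r j → entry (updateAt η r f) t r j ≡ + m ℤ.* lookup t r ℤ.+ lookup λ' j ℤ.- f (lookup η r)
    entry-move f r j = cong (λ y → + m ℤ.* lookup t r ℤ.+ lookup λ' j ℤ.- y) (VP.lookup∘updateAt r η)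
    rowDerivative : ∀ r j → ∂ (besselMatrix η t r j) ≈ besselMatrix (move η (r , true)) t r j ⊕ besselMatrix (move η (r , false)) t r j
    rowDerivative r j = mk≈ λ k → trans (besselI2x-derivative (entry η t r j) k) (cong₂ ℚ._+_
      (cong (λ ν → besselI2x ν k) (sym (trans (entry-move (ℤ._+ + 1) r j) (shift+ (+ m ℤ.* lookup t r) (lookup λ' j) (lookup η r)))))
      (cong (λ ν → besselI2x ν k) (sym (trans (entry-move (ℤ._- + 1) r j) (shift- (+ m ℤ.* lookup t r) (lookup λ' j) (lookup η r))))))

  ∂-detTerm-coeff : ∀ η t k → ι (suc k) ℚ.* Det η t (suc k) ≡ sumMap (λ s → Det (move η s) t k) (allSteps n)
  ∂-detTerm-coeff η t k =
    trans (coeff (∂-detTerm η t) k)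
    (trans (sum-coeff (λ r → Det (move η (r , true)) t ⊕ Det (move η (r , false)) t) k)
           (sym (sumMap-allSteps n (λ s → Det (move η s) t k))))

  summand : Vec ℤ n → ℕ → Vec ℤ n → ℚ
  summand η k t = ifᵈ (sumℤ t ℤ.≟ + 0) then Det η t k

  rhsBox≡boxSum : ∀ η B k → rhsBox n m η λ' B k ≡ boxSum n (rangeℤ B) (summand η k)
  rhsBox≡boxSum η B k =
    trans (sumS-coeff (L.map (Det η) (boxZeroSum n B)) k)
    (trans (sumMap-map (λ f → f k) (Det η) (boxZeroSum n B))
           (sumMap-filter (λ t → sumℤ t ℤ.≟ + 0) (λ t → Det η t k) (vecsOver n (rangeℤ B))))

  boxSum-summand-suc : ∀ η k xs →
    ι (suc k) ℚ.* boxSum n xs (summand η (suc k)) ≡ sumMap (λ s → boxSum n xs (summand (move η s) k)) (allSteps n)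
  boxSum-summand-suc η k xs = begin
    ι (suc k) ℚ.* boxSum n xs (summand η (suc k))
      ≡⟨ *-distribˡ-sumMap (ι (suc k)) (summand η (suc k)) (vecsOver n xs) ⟨
    sumMap (λ t → ι (suc k) ℚ.* summand η (suc k) t) (vecsOver n xs)
      ≡⟨ sumMap-cong (vecsOver n xs) step ⟩
    sumMap (λ t → sumMap (λ s → summand (move η s) k t) (allSteps n)) (vecsOver n xs)
      ≡⟨ sumMap-comm (λ t s → summand (move η s) k t) (vecsOver n xs) (allSteps n) ⟩
    sumMap (λ s → boxSum n xs (summand (move η s) k)) (allSteps n) ∎
    where
    open ≡-Reasoning
    step : ∀ t → ι (suc k) ℚ.* summand η (suc k) t ≡ sumMap (λ s → summand (move η s) k t) (allSteps n)
    step t = trans (*-ifᵈ (sumℤ t ℤ.≟ + 0) (ι (suc k)) (Det η t (suc k)))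
             (trans (cong (ifᵈ (sumℤ t ℤ.≟ + 0) then_) (∂-detTerm-coeff η t k))
                    (ifᵈ-sumMap (sumℤ t ℤ.≟ + 0) (λ s → Det (move η s) t k) (allSteps n)))

  supportRadius : ℕ → Vec ℤ n → ℕ
  supportRadius k η = k ℕ.+ ‖ λ' ‖₁ ℕ.+ ‖ η ‖₁

  -- A large |tᵢ| makes every entry of row i large, and I_ν vanishes below order |ν|.
  summand-supported : 1 ℕ.≤ m → ∀ η k → SupportedIn (supportRadius k η) (summand η k)
  summand-supported 1≤m η k t i R<∣tᵢ∣ = ifᵈ-zero (sumℤ t ℤ.≟ + 0) (Det η t k) λ _ →
    det-vanish-row k n (besselMatrix η t) i
      (λ j k′ k′≤k → besselI2x-belowOrder (entry η t i j) k′ (ℕP.≤-<-trans k′≤k (k<∣entry∣ j))) k ℕP.≤-refl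
    where
    k<∣entry∣ : ∀ j → k ℕ.< ℤ.∣ entry η t i j ∣
    k<∣entry∣ j = ℕP.≰⇒> λ ∣entry∣≤k → ℕP.<⇒≱ R<∣tᵢ∣
      (ℕP.≤-trans (∣t∣≤∣mt+a-b∣+∣a∣+∣b∣ m (lookup t i) (lookup λ' j) (lookup η i) 1≤m)
                  (ℕP.+-mono-≤ (ℕP.+-mono-≤ ∣entry∣≤k (∣lookup∣≤‖‖₁ λ' j)) (∣lookup∣≤‖‖₁ η i)))

  summand-antisymmetric : ∀ η k (φ : Vec ℤ n → Vec ℤ n) (a b : Fin n) → a ≢ b →
    (∀ t → sumℤ (φ t) ≡ sumℤ t) → (∀ t → RowsSwapped n a b (besselMatrix η t) (besselMatrix η (φ t))) →
    ∀ t → summand η k (φ t) ≡ ℚ.- summand η k t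
  summand-antisymmetric η k φ a b a≢b sum-φ swapped t =
    trans (ifᵈ-cong (sumℤ (φ t) ℤ.≟ + 0) (sumℤ t ℤ.≟ + 0) (trans (sym (sum-φ t))) (trans (sum-φ t)) _)
    (trans (cong (ifᵈ (sumℤ t ℤ.≟ + 0) then_) (coeff (det-rowsSwapped n a b a≢b _ _ (swapped t)) k))
           (ifᵈ-neg (sumℤ t ℤ.≟ + 0) (Det η t k)))

  boxSum-summand-wall : ∀ η (a b : Fin n) → a ≢ b → lookup η a ≡ lookup η b → ∀ xs k → boxSum n xs (summand η k) ≡ 0ℚ
  boxSum-summand-wall η a b a≢b ηa≡ηb xs k =
    boxSum-antiInvariant n xs (summand η k) (swapAt a b) (boxSum-swap n a b xs (summand η k))
      (summand-antisymmetric η k (swapAt a b) a b a≢b (λ t → sumℤ-swapAt t a b a≢b) swapped)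
    where
    swapped : ∀ t → RowsSwapped n a b (besselMatrix η t) (besselMatrix η (swapAt a b t))
    swapped t = mkSwapped
      (λ j → ≈-reflexive (cong₂ (λ x y → besselI2x (+ m ℤ.* x ℤ.+ lookup λ' j ℤ.- y)) (lookup-swapAt-a t a b a≢b) ηa≡ηb))
      (λ j → ≈-reflexive (cong₂ (λ x y → besselI2x (+ m ℤ.* x ℤ.+ lookup λ' j ℤ.- y)) (lookup-swapAt-b t a b) (sym ηa≡ηb)))
      (λ i j i≢a i≢b → ≈-reflexive (cong (λ x → besselI2x (+ m ℤ.* x ℤ.+ lookup λ' j ℤ.- lookup η i)) (lookup-swapAt-other t a b i i≢a i≢b)))

  boxSum-summand-affineWall : 1 ℕ.≤ m → ∀ η (z l : Fin n) → z ≢ l → lookup η z ≡ lookup η l ℤ.+ + m →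
    ∀ k B → supportRadius k η ℕ.+ 2 ℕ.≤ B → boxSum n (rangeℤ B) (summand η k) ≡ 0ℚ
  boxSum-summand-affineWall 1≤m η z l z≢l ηz≡ηl+m k B R+2≤B =
    boxSum-antiInvariant n (rangeℤ B) (summand η k) (affineSwap z l)
      (boxSum-affineSwap n z l z≢l (supportRadius k η) B (summand η k) (summand-supported 1≤m η k)
                         (subst (ℕ._≤ B) (ℕP.+-comm (supportRadius k η) 2) R+2≤B))
      (summand-antisymmetric η k (affineSwap z l) z l z≢l (sumℤ-affineSwap z l z≢l) swapped)
    where
    up : ∀ (μ x y w : ℤ) → μ ℤ.* (x ℤ.+ + 1) ℤ.+ y ℤ.- (w ℤ.+ μ) ≡ μ ℤ.* x ℤ.+ y ℤ.- w
    up = ℤ-Solver.solve-∀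
    down : ∀ (μ x y w : ℤ) → μ ℤ.* (x ℤ.- + 1) ℤ.+ y ℤ.- w ≡ μ ℤ.* x ℤ.+ y ℤ.- (w ℤ.+ μ)
    down = ℤ-Solver.solve-∀
    swapped : ∀ t → RowsSwapped n z l (besselMatrix η t) (besselMatrix η (affineSwap z l t))
    swapped t = mkSwapped
      (λ j → ≈-reflexive (cong besselI2x (trans (cong₂ (λ x y → + m ℤ.* x ℤ.+ lookup λ' j ℤ.- y) (lookup-affineSwap-z z l z≢l t) ηz≡ηl+m)
                                                (up (+ m) (lookup t l) (lookup λ' j) (lookup η l)))))
      (λ j → ≈-reflexive (cong besselI2x (trans (cong (λ x → + m ℤ.* x ℤ.+ lookup λ' j ℤ.- lookup η l) (lookup-affineSwap-l z l z≢l t))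
                                         (trans (down (+ m) (lookup t z) (lookup λ' j) (lookup η l))
                                                (cong (λ y → + m ℤ.* lookup t z ℤ.+ lookup λ' j ℤ.- y) (sym ηz≡ηl+m))))))
      (λ i j i≢z i≢l → ≈-reflexive (cong (λ x → besselI2x (+ m ℤ.* x ℤ.+ lookup λ' j ℤ.- lookup η i))
                                         (lookup-affineSwap-other z l z≢l t i i≢z i≢l)))

-- The alcove and its walls

<⇒+1≤ : ∀ {a b} → a ℤ.< b → a ℤ.+ + 1 ℤ.≤ b
<⇒+1≤ {a} a<b = subst (ℤ._≤ _) (ℤP.+-comm (+ 1) a) (ℤP.i<j⇒suc[i]≤j a<b)

<⇒≤-1 : ∀ {a b} → a ℤ.< b → a ℤ.≤ b ℤ.- + 1
<⇒≤-1 {a} {b} a<b = subst (a ℤ.≤_) (ℤP.+-comm ℤ.-1ℤ b) (ℤP.i<j⇒i≤pred[j] a<b)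

Decreasing : ∀ {n} → Vec ℤ n → Set
Decreasing v = Linked ℤ._>_ (toList v)

NonIncreasing : ∀ {n} → Vec ℤ n → Set
NonIncreasing v = Linked ℤ._≥_ (toList v)

decreasing-head : ∀ {n} x (v : Vec ℤ n) → Decreasing (x V.∷ v) → ∀ j → lookup v j ℤ.< x
decreasing-head x (y V.∷ w) (x>y ∷ _)  zero    = x>y
decreasing-head x (y V.∷ w) (x>y ∷ dec) (suc j) = ℤP.<-trans (decreasing-head y w dec j) x>y

decreasing-mono : ∀ {n} (v : Vec ℤ n) → Decreasing v → ∀ i j → toℕ i ℕ.< toℕ j → lookup v j ℤ.< lookup v i
decreasing-mono (x V.∷ w) dec zero    (suc j) _         = decreasing-head x w dec j
decreasing-mono (x V.∷ w) dec (suc i) (suc j) (s≤s i<j) = decreasing-mono w (Linked.tail dec) i j i<j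

decreasing-injective : ∀ {n} (v : Vec ℤ n) → Decreasing v → ∀ i j → i ≢ j → lookup v i ≢ lookup v j
decreasing-injective v dec i j i≢j vᵢ≡vⱼ with ℕP.<-cmp (toℕ i) (toℕ j)
... | tri< i<j _ _ = ℤP.<-irrefl (sym vᵢ≡vⱼ) (decreasing-mono v dec i j i<j)
... | tri≈ _ i≡j _ = i≢j (FP.toℕ-injective i≡j)
... | tri> _ _ j<i = ℤP.<-irrefl vᵢ≡vⱼ (decreasing-mono v dec j i j<i)

lastOr≡lookup-last : ∀ {n} x (w : Vec ℤ n) → lastOr x (toList w) ≡ lookup (x V.∷ w) (F.fromℕ n)
lastOr≡lookup-last x V.[]      = refl
lastOr≡lookup-last x (y V.∷ w) = lastOr≡lookup-last y w

decreasing-≤head : ∀ {n} x (w : Vec ℤ n) → Decreasing (x V.∷ w) → ∀ j → lookup (x V.∷ w) j ℤ.≤ x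
decreasing-≤head x w dec zero    = ℤP.≤-refl
decreasing-≤head x w dec (suc j) = ℤP.<⇒≤ (decreasing-head x w dec j)

decreasing-last≤ : ∀ {n} (v : Vec ℤ (suc n)) → Decreasing v → ∀ j → lookup v (F.fromℕ n) ℤ.≤ lookup v j
decreasing-last≤ {n} v dec j with ℕP.<-cmp (toℕ j) n
... | tri< j<n _ _ = ℤP.<⇒≤ (decreasing-mono v dec j (F.fromℕ n) (subst (toℕ j ℕ.<_) (sym (FP.toℕ-fromℕ n)) j<n))
... | tri≈ _ j≡n _ = ℤP.≤-reflexive (cong (lookup v) (FP.toℕ-injective (trans (FP.toℕ-fromℕ n) (sym j≡n))))
... | tri> _ _ n<j = ⊥-elim (ℕP.<⇒≱ n<j (ℕP.≤-pred (FP.toℕ<n j)))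

wrap⇔ : ∀ {n} m (v : Vec ℤ (suc n)) → WrapCond m (toList v) ≡ (lookup v zero ℤ.- + m ℤ.< lookup v (F.fromℕ n))
wrap⇔ m (x V.∷ w) = cong (x ℤ.- + m ℤ.<_) (lastOr≡lookup-last x w)

InR⇒<+m : ∀ {n} m (v : Vec ℤ (suc n)) → InR m v → ∀ a b → lookup v a ℤ.< lookup v b ℤ.+ + m
InR⇒<+m m (x V.∷ w) (dec , wrap) a b =
  ℤP.≤-<-trans (decreasing-≤head x w dec a)
    (ℤP.<-≤-trans (subst (ℤ._< lookup (x V.∷ w) (F.fromℕ _) ℤ.+ + m) (cancel x (+ m)) (ℤP.+-monoˡ-< (+ m) (subst (λ P → P) (wrap⇔ m (x V.∷ w)) wrap)))
                  (ℤP.+-monoˡ-≤ (+ m) (decreasing-last≤ (x V.∷ w) dec b)))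
  where
  cancel : ∀ x m → x ℤ.- m ℤ.+ m ≡ x
  cancel = ℤ-Solver.solve-∀

UnitStep : (ℤ → ℤ) → Set
UnitStep f = (∀ x → f x ℤ.≤ x ℤ.+ + 1) × (∀ x → x ℤ.- + 1 ℤ.≤ f x)

unitStep+ : UnitStep (ℤ._+ + 1)
unitStep+ = (λ x → ℤP.≤-refl) , (λ x → ℤP.+-monoʳ-≤ x (ℤ.-≤+ {0} {1}))

unitStep- : UnitStep (ℤ._- + 1)
unitStep- = (λ x → ℤP.+-monoʳ-≤ x (ℤ.-≤+ {0} {1})) , (λ x → ℤP.≤-refl)

decreasing-updateAt : ∀ {n} (v : Vec ℤ n) r f → UnitStep f → Decreasing v → NonIncreasing (updateAt v r f)
decreasing-updateAt (x V.∷ V.[])      zero          f _ _ = [-]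
decreasing-updateAt (x V.∷ y V.∷ w) zero          f (_ , below) (x>y ∷ dec) = ℤP.≤-trans (<⇒≤-1 x>y) (below x) ∷ Linked.map ℤP.<⇒≤ dec
decreasing-updateAt (x V.∷ y V.∷ w) (suc zero)    f step@(above , _) (x>y ∷ dec) =
  ℤP.≤-trans (above y) (<⇒+1≤ x>y) ∷ decreasing-updateAt (y V.∷ w) zero f step dec
decreasing-updateAt (x V.∷ y V.∷ w) (suc (suc r)) f step (x>y ∷ dec) =
  ℤP.<⇒≤ x>y ∷ decreasing-updateAt (y V.∷ w) (suc r) f step dec

EqualPair : ∀ {n} → Vec ℤ n → Set
EqualPair {n} v = Σ (Fin n) λ a → Σ (Fin n) λ b → a ≢ b × lookup v a ≡ lookup v b

nonIncreasing⇒decreasing⊎equalPair : ∀ {n} (v : Vec ℤ n) → NonIncreasing v → Decreasing v ⊎ EqualPair v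
nonIncreasing⇒decreasing⊎equalPair V.[]              _ = inj₁ []
nonIncreasing⇒decreasing⊎equalPair (x V.∷ V.[])      _ = inj₁ [-]
nonIncreasing⇒decreasing⊎equalPair (x V.∷ y V.∷ w) (x≥y ∷ nonInc) with nonIncreasing⇒decreasing⊎equalPair (y V.∷ w) nonInc
... | inj₂ (a , b , a≢b , eq) = inj₂ (suc a , suc b , a≢b ∘ FP.suc-injective , eq)
... | inj₁ dec with x ℤ.≟ y
...   | yes x≡y = inj₂ (zero , suc zero , (λ ()) , x≡y)
...   | no x≢y  = inj₁ (ℤP.≤∧≢⇒< x≥y (x≢y ∘ sym) ∷ dec)

OnWall : ∀ {n} → ℕ → Vec ℤ n → Set
OnWall {n} m v = EqualPair v ⊎ (Σ (Fin n) λ z → Σ (Fin n) λ l → z ≢ l × lookup v z ≡ lookup v l ℤ.+ + m)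

OnWall⇒∉R : ∀ {n} m (v : Vec ℤ (suc n)) → OnWall m v → ¬ InR m v
OnWall⇒∉R m v (inj₁ (a , b , a≢b , eq)) inR = decreasing-injective v (proj₁ inR) a b a≢b eq
OnWall⇒∉R m v (inj₂ (z , l , _ , eq))   inR = ℤP.<-irrefl eq (InR⇒<+m m v inR z l)

wrap-updateAt : ∀ {n} m (η : Vec ℤ (suc (suc n))) → InR m η → ∀ r f → UnitStep f →
  lookup (updateAt η r f) zero ℤ.- + m ℤ.≤ lookup (updateAt η r f) (F.fromℕ (suc n))
wrap-updateAt {n} m η (dec , wrap) r f (above , below) with r F.≟ zero | r F.≟ F.fromℕ (suc n)
... | yes refl | _ =
  subst₂ ℤ._≤_ (sym (cong (ℤ._- + m) (VP.lookup∘updateAt zero η))) (sym (VP.lookup∘updateAt′ last zero (λ ()) η))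
    (ℤP.≤-trans (ℤP.+-monoˡ-≤ (ℤ.- + m) (above (lookup η zero))) (subst (ℤ._≤ _) (commute (lookup η zero) (+ m)) (<⇒+1≤ wrap′)))
  where
  last = F.fromℕ (suc n)
  wrap′ = subst (λ P → P) (wrap⇔ m η) wrap
  commute : ∀ h m → h ℤ.- m ℤ.+ + 1 ≡ h ℤ.+ + 1 ℤ.- m
  commute = ℤ-Solver.solve-∀
... | no _ | yes refl =
  subst₂ ℤ._≤_ (sym (cong (ℤ._- + m) (VP.lookup∘updateAt′ zero last (λ ()) η))) (sym (VP.lookup∘updateAt last η))
    (ℤP.≤-trans (<⇒≤-1 (subst (λ P → P) (wrap⇔ m η) wrap)) (below (lookup η last)))
  where last = F.fromℕ (suc n)
... | no r≢0 | no r≢last =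
  subst₂ ℤ._≤_ (sym (cong (ℤ._- + m) (VP.lookup∘updateAt′ zero r (r≢0 ∘ sym) η)))
               (sym (VP.lookup∘updateAt′ (F.fromℕ (suc n)) r (r≢last ∘ sym) η))
    (ℤP.<⇒≤ (subst (λ P → P) (wrap⇔ m η) wrap))

InR-updateAt : ∀ {n} m (η : Vec ℤ (suc (suc n))) → InR m η → ∀ r f → UnitStep f →
  InR m (updateAt η r f) ⊎ OnWall m (updateAt η r f)
InR-updateAt {n} m η inR r f step
  with nonIncreasing⇒decreasing⊎equalPair (updateAt η r f) (decreasing-updateAt η r f step (proj₁ inR))
... | inj₂ equal = inj₂ (inj₁ equal)
... | inj₁ dec with lookup (updateAt η r f) zero ℤ.- + m ℤ.≟ lookup (updateAt η r f) (F.fromℕ (suc n))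
...   | yes eq = inj₂ (inj₂ (zero , F.fromℕ (suc n) , (λ ()) , trans (sym (cancel _ (+ m))) (cong (ℤ._+ + m) eq)))
  where
  cancel : ∀ h m → h ℤ.- m ℤ.+ m ≡ h
  cancel = ℤ-Solver.solve-∀
...   | no ≢ = inj₁ (dec , subst (λ P → P) (sym (wrap⇔ m (updateAt η r f))) (ℤP.≤∧≢⇒< (wrap-updateAt m η inR r f step) ≢))

InR-move : ∀ {n} m (η : Vec ℤ (suc (suc n))) → InR m η → ∀ s → InR m (move η s) ⊎ OnWall m (move η s)
InR-move m η inR (r , true)  = InR-updateAt m η inR r (ℤ._+ + 1) unitStep+
InR-move m η inR (r , false) = InR-updateAt m η inR r (ℤ._- + 1) unitStep-

count : ∀ {P : Pred A 0ℓ} → Decidable P → List A → ℕ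
count P? xs = length (filter P? xs)

ι-count-concatMap : ∀ {P : Pred B 0ℓ} (P? : Decidable P) (h : A → List B) xs →
                    ι (count P? (concatMap h xs)) ≡ sumMap (λ x → ι (count P? (h x))) xs
ι-count-concatMap P? h []       = refl
ι-count-concatMap P? h (x ∷ xs) = begin
  ι (count P? (h x ++ concatMap h xs))                         ≡⟨ cong (ι ∘ length) (LP.filter-++ P? (h x) (concatMap h xs)) ⟩
  ι (length (filter P? (h x) ++ filter P? (concatMap h xs)))   ≡⟨ cong ι (LP.length-++ (filter P? (h x))) ⟩
  ι (count P? (h x) ℕ.+ count P? (concatMap h xs))              ≡⟨ ι-+ (count P? (h x)) _ ⟩
  ι (count P? (h x)) ℚ.+ ι (count P? (concatMap h xs))          ≡⟨ cong (ι (count P? (h x)) ℚ.+_) (ι-count-concatMap P? h xs) ⟩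
  sumMap (λ x → ι (count P? (h x))) (x ∷ xs)                   ∎
  where open ≡-Reasoning

count-map : ∀ {P : Pred B 0ℓ} (P? : Decidable P) (g : A → B) xs → count P? (L.map g xs) ≡ count (P? ∘ g) xs
count-map P? g []       = refl
count-map P? g (x ∷ xs) with P? (g x)
... | yes _ = cong suc (count-map P? g xs)
... | no _  = count-map P? g xs

module Walks (n m : ℕ) (λ' : Vec ℤ n) where

  walks : Vec ℤ n → ℕ → ℕ
  walks η k = numWalks n m η λ' k

  ι-walks-suc : ∀ η k → InR m η → ι (walks η (suc k)) ≡ sumMap (λ s → ι (walks (move η s) k)) (allSteps n)
  ι-walks-suc η k η∈R =
    trans (ι-count-concatMap (validWalk? m η λ') (λ s → L.map (s ∷_) (stepSeqs n k)) (allSteps n))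
          (sumMap-cong (allSteps n) λ s → cong ι (trans (count-map (validWalk? m η λ') (s ∷_) (stepSeqs n k))
            (cong length (LP.filter-≐ (λ w → validWalk? m η λ' (s ∷ w)) (validWalk? m (move η s) λ')
              ((λ valid → All.tail (proj₁ valid) , proj₂ valid) , (λ valid → η∈R ∷ proj₁ valid , proj₂ valid))
              (stepSeqs n k)))))

  walks-∉R : ∀ η k → ¬ InR m η → walks η k ≡ 0
  walks-∉R η k η∉R = cong length (LP.filter-none (validWalk? m η λ') (All.universal startsOutside (stepSeqs n k)))
    where
    startsOutside : ∀ w → ¬ ValidWalk m η λ' w
    startsOutside []      (η∈R ∷ _ , _) = η∉R η∈R
    startsOutside (_ ∷ _) (η∈R ∷ _ , _) = η∉R η∈R

  walks-zero-self : InR m λ' → walks λ' 0 ≡ 1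
  walks-zero-self λ'∈R = cong length (LP.filter-accept (validWalk? m λ' λ') {x = []} {xs = []} ((λ'∈R ∷ All.[]) , refl))

  walks-zero-other : ∀ η → η ≢ λ' → walks η 0 ≡ 0
  walks-zero-other η η≢λ' = cong length (LP.filter-reject (validWalk? m η λ') {x = []} {xs = []} (η≢λ' ∘ proj₂))

-- The constant term

sumℤ≤0 : ∀ {n} (v : Vec ℤ n) → (∀ j → lookup v j ℤ.≤ + 0) → sumℤ v ℤ.≤ + 0
sumℤ≤0 V.[]      nonPos = ℤP.≤-refl
sumℤ≤0 (x V.∷ w) nonPos = ℤP.+-mono-≤ (nonPos zero) (sumℤ≤0 w (nonPos ∘ suc))

sumℤ≤lookup : ∀ {n} (v : Vec ℤ n) → (∀ j → lookup v j ℤ.≤ + 0) → ∀ i → sumℤ v ℤ.≤ lookup v i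
sumℤ≤lookup (x V.∷ w) nonPos zero    = subst (x ℤ.+ sumℤ w ℤ.≤_) (ℤP.+-identityʳ x) (ℤP.+-monoʳ-≤ x (sumℤ≤0 w (nonPos ∘ suc)))
sumℤ≤lookup (x V.∷ w) nonPos (suc i) =
  ℤP.≤-trans (subst (x ℤ.+ sumℤ w ℤ.≤_) (ℤP.+-identityˡ (sumℤ w)) (ℤP.+-monoˡ-≤ (sumℤ w) (nonPos zero)))
             (sumℤ≤lookup w (nonPos ∘ suc) i)

0≤sumℤ : ∀ {n} (v : Vec ℤ n) → (∀ j → + 0 ℤ.≤ lookup v j) → + 0 ℤ.≤ sumℤ v
0≤sumℤ V.[]      nonNeg = ℤP.≤-refl
0≤sumℤ (x V.∷ w) nonNeg = ℤP.+-mono-≤ (nonNeg zero) (0≤sumℤ w (nonNeg ∘ suc))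

lookup≤sumℤ : ∀ {n} (v : Vec ℤ n) → (∀ j → + 0 ℤ.≤ lookup v j) → ∀ i → lookup v i ℤ.≤ sumℤ v
lookup≤sumℤ (x V.∷ w) nonNeg zero    = subst (ℤ._≤ x ℤ.+ sumℤ w) (ℤP.+-identityʳ x) (ℤP.+-monoʳ-≤ x (0≤sumℤ w (nonNeg ∘ suc)))
lookup≤sumℤ (x V.∷ w) nonNeg (suc i) =
  ℤP.≤-trans (lookup≤sumℤ w (nonNeg ∘ suc) i)
             (subst (ℤ._≤ x ℤ.+ sumℤ w) (ℤP.+-identityˡ (sumℤ w)) (ℤP.+-monoˡ-≤ (sumℤ w) (nonNeg zero)))

sumℤ≡0⇒positive×negative : ∀ {n} (v : Vec ℤ n) i → sumℤ v ≡ + 0 → lookup v i ≢ + 0 →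
  (Σ (Fin n) λ p → + 1 ℤ.≤ lookup v p) × (Σ (Fin n) λ q → lookup v q ℤ.≤ ℤ.- + 1)
sumℤ≡0⇒positive×negative {n} v i Σv≡0 vᵢ≢0 = positive , negative
  where
  positive : Σ (Fin n) λ p → + 1 ℤ.≤ lookup v p
  positive with FP.all? (λ p → lookup v p ℤ.≤? + 0)
  ... | yes nonPos = ⊥-elim (vᵢ≢0 (ℤP.≤-antisym (nonPos i) (subst (ℤ._≤ lookup v i) Σv≡0 (sumℤ≤lookup v nonPos i))))
  ... | no ¬nonPos with FP.¬∀⟶∃¬ n _ (λ p → lookup v p ℤ.≤? + 0) ¬nonPos
  ...   | p , vₚ≰0 = p , <⇒+1≤ (ℤP.≰⇒> vₚ≰0)
  negative : Σ (Fin n) λ q → lookup v q ℤ.≤ ℤ.- + 1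
  negative with FP.all? (λ q → + 0 ℤ.≤? lookup v q)
  ... | yes nonNeg = ⊥-elim (vᵢ≢0 (ℤP.≤-antisym (subst (lookup v i ℤ.≤_) Σv≡0 (lookup≤sumℤ v nonNeg i)) (nonNeg i)))
  ... | no ¬nonNeg with FP.¬∀⟶∃¬ n _ (λ q → + 0 ℤ.≤? lookup v q) ¬nonNeg
  ...   | q , 0≰v_q = q , <⇒≤-1 (ℤP.≰⇒> 0≰v_q)

-- If m t_p = η_p - λ_j with t_p ≥ 1 and m t_q = η_q - λ_j′ with t_q ≤ -1, then
-- (η_p - η_q) + (λ_j′ - λ_j) ≥ 2m, which two differences of size < m cannot reach.
opposite-translates-incompatible : ∀ m {ηp ηq λj λj′ tp tq : ℤ} →
  + m ℤ.* tp ℤ.+ λj ℤ.- ηp ≡ + 0 → + m ℤ.* tq ℤ.+ λj′ ℤ.- ηq ≡ + 0 →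
  + 1 ℤ.≤ tp → tq ℤ.≤ ℤ.- + 1 → ηp ℤ.< ηq ℤ.+ + m → λj′ ℤ.< λj ℤ.+ + m → ⊥
opposite-translates-incompatible m {ηp} {ηq} {λj} {λj′} {tp} {tq} hit-p hit-q 1≤tp tq≤-1 ηp<ηq+m λj′<λj+m =
  ℤP.<-asym λj′<λj+m (ℤP.≤-<-trans λj+m≤ηp (ℤP.<-≤-trans ηp<ηq+m ηq+m≤λj′))
  where
  solveFor : ∀ a b c → a ℤ.+ b ℤ.- c ≡ + 0 → b ≡ c ℤ.- a
  solveFor a b c eq = trans (sym (rearrange a b c)) (trans (cong (λ z → z ℤ.- a ℤ.+ c) eq) (rearrange′ a c))
    where
    rearrange : ∀ a b c → a ℤ.+ b ℤ.- c ℤ.- a ℤ.+ c ≡ b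
    rearrange = ℤ-Solver.solve-∀
    rearrange′ : ∀ a c → + 0 ℤ.- a ℤ.+ c ≡ c ℤ.- a
    rearrange′ = ℤ-Solver.solve-∀
  m≤mtp : + m ℤ.≤ + m ℤ.* tp
  m≤mtp = subst (ℤ._≤ + m ℤ.* tp) (ℤP.*-identityʳ (+ m)) (ℤP.*-monoˡ-≤-nonNeg (+ m) 1≤tp)
  mtq≤-m : + m ℤ.* tq ℤ.≤ ℤ.- + m
  mtq≤-m = subst (+ m ℤ.* tq ℤ.≤_) (trans (ℤP.*-comm (+ m) (ℤ.- + 1)) (ℤP.-1*i≡-i (+ m))) (ℤP.*-monoˡ-≤-nonNeg (+ m) tq≤-1)
  λj+m≤ηp : λj ℤ.+ + m ℤ.≤ ηp
  λj+m≤ηp = subst₂ ℤ._≤_ (trans (rearrange ηp (+ m ℤ.* tp) (+ m)) (cong (ℤ._+ + m) (sym (solveFor (+ m ℤ.* tp) λj ηp hit-p))))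
                         (cancel ηp (+ m))
                         (ℤP.+-monoʳ-≤ (ηp ℤ.+ + m) (ℤP.neg-mono-≤ m≤mtp))
    where
    rearrange : ∀ a b c → a ℤ.+ c ℤ.+ ℤ.- b ≡ a ℤ.- b ℤ.+ c
    rearrange = ℤ-Solver.solve-∀
    cancel : ∀ a b → a ℤ.+ b ℤ.+ ℤ.- b ≡ a
    cancel = ℤ-Solver.solve-∀
  ηq+m≤λj′ : ηq ℤ.+ + m ℤ.≤ λj′
  ηq+m≤λj′ = subst₂ ℤ._≤_ refl (sym (solveFor (+ m ℤ.* tq) λj′ ηq hit-q))
               (ℤP.+-monoʳ-≤ ηq (subst (ℤ._≤ ℤ.- (+ m ℤ.* tq)) (ℤP.neg-involutive (+ m)) (ℤP.neg-mono-≤ mtq≤-m)))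

decreasing-≢⇒unmatched : ∀ {n} (η λ' : Vec ℤ n) → Decreasing η → Decreasing λ' → η ≢ λ' →
  Σ (Fin n) λ i → (∀ j → lookup λ' j ≢ lookup η i) ⊎ (∀ i′ → lookup η i′ ≢ lookup λ' i)
decreasing-≢⇒unmatched V.[] V.[] _ _ η≢λ' = ⊥-elim (η≢λ' refl)
decreasing-≢⇒unmatched (x V.∷ η) (y V.∷ λ') decη decλ η≢λ' with ℤP.<-cmp x y
... | tri< x<y _ _ = zero , inj₂ λ { zero eq → ℤP.<-irrefl eq x<y
                                   ; (suc i′) eq → ℤP.<-irrefl eq (ℤP.<-trans (decreasing-head x η decη i′) x<y) }
... | tri> _ _ y<x = zero , inj₁ λ { zero eq → ℤP.<-irrefl eq y<x
                                   ; (suc j) eq → ℤP.<-irrefl eq (ℤP.<-trans (decreasing-head y λ' decλ j) y<x) }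
... | tri≈ _ refl _ with decreasing-≢⇒unmatched η λ' (Linked.tail decη) (Linked.tail decλ) (η≢λ' ∘ cong (x V.∷_))
...   | i , inj₁ unmatched = suc i , inj₁ λ { zero eq → ℤP.<-irrefl (sym eq) (decreasing-head x η decη i)
                                            ; (suc j) eq → unmatched j eq }
...   | i , inj₂ unmatched = suc i , inj₂ λ { zero eq → ℤP.<-irrefl (sym eq) (decreasing-head x λ' decλ i)
                                            ; (suc i′) eq → unmatched i′ eq }

⊗-coeff-zero : ∀ f g → (f ⊗ g) 0 ≡ f 0 ℚ.* g 0
⊗-coeff-zero f g = trans (⊗-coeff f g 0) (ℚP.+-identityʳ _)

det-constant-identity : ∀ n (M : Mat n) → (∀ i → M i i 0 ≡ 1ℚ) → (∀ i j → i ≢ j → M i j 0 ≡ 0ℚ) → det n M 0 ≡ 1ℚ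
det-constant-identity zero    M diag off = refl
det-constant-identity (suc n) M diag off = begin
  det (suc n) M 0                                               ≡⟨ coeff (det-laplace n M) 0 ⟩
  laplaceTerm M zero 0 ℚ.+ sum (λ j → laplaceTerm M (suc j)) 0  ≡⟨ cong₂ ℚ._+_ first rest ⟩
  1ℚ ℚ.* 1ℚ ℚ.+ 0ℚ                                              ≡⟨⟩
  1ℚ                                                            ∎
  where
  open ≡-Reasoning
  first : laplaceTerm M zero 0 ≡ 1ℚ ℚ.* 1ℚ
  first = trans (⊗-coeff-zero (M zero zero) (det n (minor M zero)))
                (cong₂ ℚ._*_ (diag zero) (det-constant-identity n (minor M zero) (diag ∘ suc)
                                           (λ i j i≢j → off (suc i) (suc j) (i≢j ∘ FP.suc-injective))))
  rest : sum (λ j → laplaceTerm M (suc j)) 0 ≡ 0ℚ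
  rest = Vanish≤-sum 0 (λ j → laplaceTerm M (suc j)) (λ j → Vanish≤-sgnS 0 (toℕ (suc j)) _ λ { zero _ →
           trans (⊗-coeff-zero (M zero (suc j)) (det n (minor M (suc j))))
                 (trans (cong (ℚ._* det n (minor M (suc j)) 0) (off zero (suc j) (λ ()))) (ℚP.*-zeroˡ (det n (minor M (suc j)) 0))) }) 0 z≤n

besselI2x-constant-nonzero : ∀ ν → ν ≢ + 0 → Vanish≤ 0 (besselI2x ν)
besselI2x-constant-nonzero ν ν≢0 zero _ = besselI2x-belowOrder ν 0 (ℕP.n≢0⇒n>0 (ν≢0 ∘ ℤP.∣i∣≡0⇒i≡0))

sumℤ-replicate-0 : ∀ n → sumℤ (V.replicate n (+ 0)) ≡ + 0
sumℤ-replicate-0 zero    = refl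
sumℤ-replicate-0 (suc n) = trans (ℤP.+-identityˡ _) (sumℤ-replicate-0 n)

module Alcove (n′ m : ℕ) (1≤m : 1 ℕ.≤ m) (λ' : Vec ℤ (suc (suc n′))) (λ'∈R : InR m λ') where

  n : ℕ
  n = suc (suc n′)

  open AlternatingSum n m λ'
  open Walks n m λ'

  0̄ : Vec ℤ n
  0̄ = V.replicate n (+ 0)

  entry-0̄ : ∀ η i j → entry η 0̄ i j ≡ lookup λ' j ℤ.- lookup η i
  entry-0̄ η i j = trans (cong (λ z → + m ℤ.* z ℤ.+ lookup λ' j ℤ.- lookup η i) (VP.lookup-replicate i (+ 0)))
                        (drop (+ m) (lookup λ' j) (lookup η i))
    where
    drop : ∀ a b c → a ℤ.* + 0 ℤ.+ b ℤ.- c ≡ b ℤ.- c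
    drop = ℤ-Solver.solve-∀

  entry-0̄≢0 : ∀ η i j → lookup λ' j ≢ lookup η i → entry η 0̄ i j ≢ + 0
  entry-0̄≢0 η i j λⱼ≢ηᵢ entry≡0 = λⱼ≢ηᵢ (trans (sym (cancel (lookup λ' j) (lookup η i))) (trans (cong (ℤ._+ lookup η i) (trans (sym (entry-0̄ η i j)) entry≡0)) (ℤP.+-identityˡ (lookup η i))))
    where
    cancel : ∀ a b → a ℤ.- b ℤ.+ b ≡ a
    cancel = ℤ-Solver.solve-∀

  -- For t ≠ 0 with Σ t = 0, a row p with t_p > 0 and a row q with t_q < 0 cannot both contain
  -- a zero index at x^0, so the constant term of the determinant vanishes.
  summand-zero-supported : ∀ η → InR m η → SupportedIn 0 (summand η 0)
  summand-zero-supported η η∈R t i 0<∣tᵢ∣ = ifᵈ-zero (sumℤ t ℤ.≟ + 0) (Det η t 0) constantVanishes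
    where
    constantVanishes : sumℤ t ≡ + 0 → Det η t 0 ≡ 0ℚ
    constantVanishes Σt≡0 with sumℤ≡0⇒positive×negative t i Σt≡0 (λ tᵢ≡0 → ℕP.<-irrefl (cong ℤ.∣_∣ (sym tᵢ≡0)) 0<∣tᵢ∣)
    ... | (p , 1≤tₚ) , (q , t_q≤-1) with FP.any? (λ j → entry η t p j ℤ.≟ + 0)
    ...   | no noHit = det-vanish-row 0 n (besselMatrix η t) p
                         (λ j → besselI2x-constant-nonzero (entry η t p j) (λ hit → noHit (j , hit))) 0 z≤n
    ...   | yes (j , hit-p) = det-vanish-row 0 n (besselMatrix η t) q
                         (λ j′ → besselI2x-constant-nonzero (entry η t q j′) λ hit-q →
                            opposite-translates-incompatible m hit-p hit-q 1≤tₚ t_q≤-1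
                              (InR⇒<+m m η η∈R p q) (InR⇒<+m m λ' λ'∈R j′ j)) 0 z≤n

  detTerm-0̄-constant : ∀ η → InR m η → Dec (η ≡ λ') → Det η 0̄ 0 ≡ ι (walks η 0)
  detTerm-0̄-constant η _ (yes refl) = trans
      (det-constant-identity n (besselMatrix λ' 0̄)
        (λ i → trans (cong (λ ν → besselI2x ν 0) (trans (entry-0̄ λ' i i) (ℤP.+-inverseʳ (lookup λ' i)))) (besselI2x-coeff 0 0))
        (λ i j i≢j → besselI2x-constant-nonzero (entry λ' 0̄ i j)
                       (entry-0̄≢0 λ' i j (decreasing-injective λ' (proj₁ λ'∈R) j i (i≢j ∘ sym))) 0 z≤n))
      (sym (trans (cong ι (walks-zero-self λ'∈R)) (ℚP.+-identityʳ 1ℚ)))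
  detTerm-0̄-constant η η∈R (no η≢λ') with decreasing-≢⇒unmatched η λ' (proj₁ η∈R) (proj₁ λ'∈R) η≢λ'
  ... | i , inj₁ unmatchedRow = trans
        (det-vanish-row 0 n (besselMatrix η 0̄) i
          (λ j → besselI2x-constant-nonzero (entry η 0̄ i j) (entry-0̄≢0 η i j (unmatchedRow j))) 0 z≤n)
        (sym (cong ι (walks-zero-other η η≢λ')))
  ... | i , inj₂ unmatchedCol = trans
        (det-vanish-col 0 n (besselMatrix η 0̄) i
          (λ i′ → besselI2x-constant-nonzero (entry η 0̄ i′ i) (entry-0̄≢0 η i′ i (unmatchedCol i′ ∘ sym))) 0 z≤n)
        (sym (cong ι (walks-zero-other η η≢λ')))

  boxSum-summand-zero : ∀ η → InR m η → ∀ B → boxSum n (rangeℤ B) (summand η 0) ≡ ι (walks η 0)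
  boxSum-summand-zero η η∈R B =
    trans (boxSum-stable n 0 B (summand η 0) (summand-zero-supported η η∈R) z≤n)
    (trans (boxSum-singleton n (+ 0) (summand η 0))
    (trans (ifᵈ-yes (sumℤ 0̄ ℤ.≟ + 0) (Det η 0̄ 0) (sumℤ-replicate-0 n))
           (detTerm-0̄-constant η η∈R (VP.≡-dec ℤ._≟_ η λ'))))

  boxSum-summand≡walks : ∀ k η → InR m η → ∀ B → supportRadius k η ℕ.+ 2 ℕ.≤ B →
                         boxSum n (rangeℤ B) (summand η k) ℚ.* ι (k !) ≡ ι (walks η k)
  boxSum-summand≡walks zero η η∈R B _ =
    trans (ℚP.*-identityʳ _) (boxSum-summand-zero η η∈R B)
  boxSum-summand≡walks (suc k) η η∈R B R+2≤B = begin
    S (suc k) η ℚ.* ι (suc k !)                                  ≡⟨ cong (S (suc k) η ℚ.*_) (ι-* (suc k) (k !)) ⟩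
    S (suc k) η ℚ.* (ι (suc k) ℚ.* ι (k !))                      ≡⟨ regroup (S (suc k) η) (ι (suc k)) (ι (k !)) ⟩
    (ι (suc k) ℚ.* S (suc k) η) ℚ.* ι (k !)                      ≡⟨ cong (ℚ._* ι (k !)) (boxSum-summand-suc η k (rangeℤ B)) ⟩
    sumMap (λ s → S k (move η s)) (allSteps n) ℚ.* ι (k !)       ≡⟨ *-distribʳ-sumMap (ι (k !)) (λ s → S k (move η s)) (allSteps n) ⟨
    sumMap (λ s → S k (move η s) ℚ.* ι (k !)) (allSteps n)       ≡⟨ sumMap-cong (allSteps n) (λ s → neighbour s (InR-move m η η∈R s)) ⟩
    sumMap (λ s → ι (walks (move η s) k)) (allSteps n)           ≡⟨ ι-walks-suc η k η∈R ⟨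
    ι (walks η (suc k))                                          ∎
    where
    open ≡-Reasoning
    S : ℕ → Vec ℤ n → ℚ
    S k η = boxSum n (rangeℤ B) (summand η k)
    regroup : ∀ a b c → a ℚ.* (b ℚ.* c) ≡ (b ℚ.* a) ℚ.* c
    regroup = solve-∀ ℚ-ring
    radius-move : ∀ s → supportRadius k (move η s) ℕ.+ 2 ℕ.≤ B
    radius-move s = ℕP.≤-trans (ℕP.+-monoˡ-≤ 2 (ℕP.≤-trans (ℕP.+-monoʳ-≤ (k ℕ.+ ‖ λ' ‖₁) (‖move‖₁ η s))
                                                            (ℕP.≤-reflexive (ℕP.+-suc (k ℕ.+ ‖ λ' ‖₁) ‖ η ‖₁))))
                               R+2≤B
    wall-vanishes : ∀ η′ → OnWall m η′ → ∀ B′ → supportRadius k η′ ℕ.+ 2 ℕ.≤ B′ → boxSum n (rangeℤ B′) (summand η′ k) ≡ 0ℚ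
    wall-vanishes η′ (inj₁ (a , b , a≢b , eq)) B′ _ = boxSum-summand-wall η′ a b a≢b eq (rangeℤ B′) k
    wall-vanishes η′ (inj₂ (z , l , z≢l , eq)) B′ R+2≤B′ = boxSum-summand-affineWall 1≤m η′ z l z≢l eq k B′ R+2≤B′
    neighbour : ∀ s → InR m (move η s) ⊎ OnWall m (move η s) → S k (move η s) ℚ.* ι (k !) ≡ ι (walks (move η s) k)
    neighbour s (inj₁ inside) = boxSum-summand≡walks k (move η s) inside B (radius-move s)
    neighbour s (inj₂ wall)   = begin
      S k (move η s) ℚ.* ι (k !)     ≡⟨ cong (ℚ._* ι (k !)) (wall-vanishes (move η s) wall B (radius-move s)) ⟩
      0ℚ ℚ.* ι (k !)                 ≡⟨ ℚP.*-zeroˡ (ι (k !)) ⟩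
      0ℚ                             ≡⟨ cong ι (walks-∉R (move η s) k (OnWall⇒∉R m (move η s) wall)) ⟨
      ι (walks (move η s) k)         ∎

mainTheorem4 : (n m : ℕ) → 2 ≤ n → NonZero m → (η λ' : Vec ℤ n) → InR m η → InR m λ' →
    (k : ℕ) → ∃ λ B → (B' : ℕ) → B ≤ B' → gSeries n m η λ' k ≡ rhsBox n m η λ' B' k
mainTheorem4 (suc (suc n′)) m (s≤s (s≤s z≤n)) m≢0 η λ' η∈R λ'∈R k =
  supportRadius k η ℕ.+ 2 , λ B′ R+2≤B′ → *-ι-cancelʳ (gSeries n m η λ' k) (rhsBox n m η λ' B′ k) (k !) {{k !≢0}} (begin
    gSeries n m η λ' k ℚ.* ι (k !)                         ≡⟨ /-*-ι (numWalks n m η λ' k) (k !) {{k !≢0}} ⟩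
    ι (numWalks n m η λ' k)                                ≡⟨ Alcove.boxSum-summand≡walks n′ m 1≤m λ' λ'∈R k η η∈R B′ R+2≤B′ ⟨
    boxSum n (rangeℤ B′) (summand η k) ℚ.* ι (k !)         ≡⟨ cong (ℚ._* ι (k !)) (rhsBox≡boxSum η B′ k) ⟨
    rhsBox n m η λ' B′ k ℚ.* ι (k !)                       ∎)
  where
  open ≡-Reasoning
  n = suc (suc n′)
  open AlternatingSum n m λ'
  1≤m : 1 ℕ.≤ m
  1≤m = ℕ.>-nonZero⁻¹ m {{m≢0}}
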